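{- For every $n$: the map $F$ restricts to a bijection from $\mathbf I_n(3412)$ onto $\mathbf S_n(132,\underline{123})$; the map $\Gamma$ restricts to a bijection from $\mathbf S_n(132,\underline{123})$ onto the set $\{(d,(0,\dots,0)) : d\in\mathcal M_n\}$ (identified with $\mathcal M_n$); the map $\Psi$ restricts to a bijection from $\mathbf I_n(3412)$ onto this same set; and $\Psi(\pi)=\Gamma(F(\pi))$ for every $\pi\in\mathbf I_n(3412)$.
   Context: $\mathcal M_n$ is the set of Motzkin paths of length $n$: words over $\{U,D,H\}$ with steps $(1,1),(1,-1),(1,0)$ from $(0,0)$ to $(n,0)$ never below the $x$-axis. $\mathbf I_n(3412)$ is the set of involutions of $\{1,\dots,n\}$ containing no subsequence (not necessarily consecutive) order-isomorphic to $3412$. $\mathbf S_n(132,\underline{123})$ is the set of $\pi\in\mathbf S_n$ with no subsequence order-isomorphic to $132$ and no three consecutive entries order-isomorphic to $123$. The map $\Gamma$: for $\pi\in\mathbf S_n$, write $\pi=w_1\cdots w_k$ as the concatenation of its ascending runs (maximal increasing factors). The first and last elements of a run of length $\ge2$ are a head and a tail; the element of a run of length $1$ is a head-tail; other elements are boarders. For each value $i$ put $d_i=H$ if $i$ is a head-tail, $U$ if a head, $D$ if a tail, $\widetilde H$ (a second-colored horizontal step) if a boarder; let $l_i=|\{j: s_j<i<t_j,\ t_j\text{ precedes } i\text{ in }\pi\}|$, $s_j,t_j$ the first and last elements of $w_j$. $\Gamma(\pi)=(d_1\cdots d_n,(l_1,\dots,l_n))$. The map $F$: write the involution in standard cycle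 notation (each cycle with least element first, cycles in decreasing order of least elements) and erase parentheses. The map $\Psi$: for an involution $\pi$, $d_i=H$ (label 0) if $i$ is a fixed point, $d_i=U$ (label 0) if $i$ is the smaller element of a 2-cycle, $d_i=D$ if $i$ is the larger element of a 2-cycle $(j,i)$, with label the number of 2-cycles $(x,y)$, $x<y$, with $j<x<i<y$; $\Psi(\pi)=(d,l)$ with $l$ the sequence of labels. -}

module Defs where

open import Data.Nat using (ℕ; zero; suc; _≤_; _<_; _≡ᵇ_; _<ᵇ_)
open import Data.Bool using (Bool; true; false; if_then_else_; _∧_)
open import Data.List using (List; []; _∷_; map; concatMap; length; applyUpTo; downFrom; replicate)
open import Data.List.Relation.Binary.Permutation.Propositional using (_↭_)
open import Data.Product using (_×_; _,_; ∃-syntax)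
open import Data.Empty using (⊥)
open import Data.Unit using (⊤)
open import Relation.Binary.PropositionalEquality using (_≡_)
open import Relation.Nullary using (¬_)

-- Permutations of {1,…,n} in one-line notation, as lists of naturals.

[1‥_] : ℕ → List ℕ
[1‥ n ] = applyUpTo suc n

IsPerm : ℕ → List ℕ → Set
IsPerm n w = w ↭ [1‥ n ]

-- 1-indexed entry:  val w i = π(i)  (junk value 0 out of range)
val : List ℕ → ℕ → ℕ
val [] _ = 0
val (x ∷ xs) zero = 0
val (x ∷ xs) (suc zero) = x
val (x ∷ xs) (suc (suc k)) = val xs (suc k)

-- 1-indexed position of the value v in w (junk if absent)
pos : List ℕ → ℕ → ℕ
pos [] v = 0
pos (x ∷ xs) v = if x ≡ᵇ v then 1 else suc (pos xs v)

countB : {A : Set} → (A → Bool) → List A → ℕ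
countB p [] = 0
countB p (x ∷ xs) = if p x then suc (countB p xs) else countB p xs

Contains3412 : List ℕ → Set
Contains3412 w = ∃[ i ] ∃[ j ] ∃[ k ] ∃[ l ]
  (1 ≤ i × i < j × j < k × k < l × l ≤ length w ×
   val w k < val w l × val w l < val w i × val w i < val w j)

Contains132 : List ℕ → Set
Contains132 w = ∃[ i ] ∃[ j ] ∃[ k ]
  (1 ≤ i × i < j × j < k × k ≤ length w ×
   val w i < val w k × val w k < val w j)

ContainsCons123 : List ℕ → Set
ContainsCons123 w = ∃[ i ]
  (1 ≤ i × suc (suc i) ≤ length w ×
   val w i < val w (suc i) × val w (suc i) < val w (suc (suc i)))

IsInvolution : ℕ → List ℕ → Set
IsInvolution n w = IsPerm n w × (∀ i → 1 ≤ i → i ≤ n → val w (val w i) ≡ i)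

I3412 : ℕ → List ℕ → Set
I3412 n w = IsInvolution n w × ¬ Contains3412 w

S132c123 : ℕ → List ℕ → Set
S132c123 n w = IsPerm n w × ¬ Contains132 w × ¬ ContainsCons123 w

-- Steps and Motzkin paths.  Ht is the second-coloured horizontal step H̃.

data Step : Set where
  U D H Ht : Step

MotzFrom : ℕ → List Step → Set
MotzFrom h [] = h ≡ 0
MotzFrom h (U ∷ s) = MotzFrom (suc h) s
MotzFrom zero (D ∷ s) = ⊥
MotzFrom (suc h) (D ∷ s) = MotzFrom h s
MotzFrom h (H ∷ s) = MotzFrom h s
MotzFrom h (Ht ∷ s) = ⊥

IsMotzkin : ℕ → List Step → Set
IsMotzkin n d = length d ≡ n × MotzFrom 0 d

MotzZero : ℕ → List Step × List ℕ → Set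
MotzZero n (d , l) = IsMotzkin n d × l ≡ replicate n 0

-- The map F: standard cycle notation of an involution (cycles with least
-- element first, cycles in decreasing order of least elements), parentheses
-- erased.

cycleAt : List ℕ → ℕ → List ℕ
cycleAt w i =
  if val w i ≡ᵇ i then i ∷ []
  else if i <ᵇ val w i then i ∷ val w i ∷ []
  else []

F : List ℕ → List ℕ
F w = concatMap (cycleAt w) (map suc (downFrom (length w)))

private
  consRun : ℕ → List (List ℕ) → List (List ℕ)
  consRun x [] = (x ∷ []) ∷ []
  consRun x ([] ∷ rs) = (x ∷ []) ∷ rs
  consRun x ((y ∷ r) ∷ rs) =
    if x <ᵇ y then (x ∷ y ∷ r) ∷ rs else (x ∷ []) ∷ (y ∷ r) ∷ rs

runs : List ℕ → List (List ℕ)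
runs [] = []
runs (x ∷ xs) = consRun x (runs xs)

runFirst : List ℕ → ℕ
runFirst [] = 0
runFirst (x ∷ _) = x

runLast : List ℕ → ℕ
runLast [] = 0
runLast (x ∷ []) = x
runLast (x ∷ y ∷ r) = runLast (y ∷ r)

-- roles within a run: head-tail H, head U, tail D, boarder Ht
private
  innerRoles : List ℕ → List (ℕ × Step)
  innerRoles [] = []
  innerRoles (z ∷ []) = (z , D) ∷ []
  innerRoles (z ∷ z' ∷ r) = (z , Ht) ∷ innerRoles (z' ∷ r)

runRoles : List ℕ → List (ℕ × Step)
runRoles [] = []
runRoles (x ∷ []) = (x , H) ∷ []
runRoles (x ∷ y ∷ r) = (x , U) ∷ innerRoles (y ∷ r)

lookupRole : ℕ → List (ℕ × Step) → Step
lookupRole i [] = H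
lookupRole i ((x , s) ∷ xs) = if x ≡ᵇ i then s else lookupRole i xs

ΓStep : List ℕ → ℕ → Step
ΓStep w i = lookupRole i (concatMap runRoles (runs w))

ΓLabel : List ℕ → ℕ → ℕ
ΓLabel w i = countB
  (λ r → (runFirst r <ᵇ i) ∧ (i <ᵇ runLast r) ∧ (pos w (runLast r) <ᵇ pos w i))
  (runs w)

Γ : List ℕ → List Step × List ℕ
Γ w = map (ΓStep w) [1‥ length w ] , map (ΓLabel w) [1‥ length w ]

ΨStep : List ℕ → ℕ → Step
ΨStep w i =
  if val w i ≡ᵇ i then H
  else if i <ᵇ val w i then U
  else D

ΨLabel : List ℕ → ℕ → ℕ
ΨLabel w i =
  if val w i <ᵇ i
  then countB (λ x → (val w i <ᵇ x) ∧ (x <ᵇ i) ∧ (i <ᵇ val w x)) [1‥ length w ]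
  else 0

Ψ : List ℕ → List Step × List ℕ
Ψ w = map (ΨStep w) [1‥ length w ] , map (ΨLabel w) [1‥ length w ]

record BijOnto {X Y : Set} (A : X → Set) (B : Y → Set) (f : X → Y) : Set where
  field
    maps-to    : ∀ x → A x → B (f x)
    injective  : ∀ x x' → A x → A x' → f x ≡ f x' → x ≡ x'
    surjective : ∀ y → B y → ∃[ x ] (A x × f x ≡ y)

module Submission where

-- All four families in the theorem are parametrized by one family
-- of plane trees, the first-return decompositions of Motzkin paths:
--   MTree ::= leaf | hstep t (a step H, then t) | arch a b (U, then a, D, then b).
-- To a tree t of size n we attach
--   * the Motzkin word flat t, and the labelled path motz t = (flat t, 0…0);
--   * the involution inv t: for hstep t the fixed point 1 followed by inv t
--     shifted by 1; for arch a b the 2-cycle (1 k), k = |a|+2, enclosing inv a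
--     shifted by 1, followed by inv b shifted by k;
--   * the permutation cyc t, the standard cycle form of inv t.

open import Defs
open import Data.Nat using (ℕ; zero; suc; _+_; _∸_; _≤_; _<_; z≤n; s≤s; _≡ᵇ_; _<ᵇ_; pred; _≤?_; _≟_)
open import Data.Nat.Properties
open import Data.Bool using (Bool; true; false; if_then_else_; _∧_; T)
open import Data.List using (List; []; _∷_; map; concatMap; concat; length; applyUpTo; downFrom; replicate; _++_; filter)
open import Data.List.Properties using (length-applyUpTo; map-applyUpTo; applyUpTo-∷ʳ; map-++; length-++; ++-assoc; map-∘; length-map; map-cong-local; map-cong; map-id; ++-identityʳ; ∷-injectiveʳ; concat-map; concatMap-++; filter-all; filter-none; filter-++)
open import Data.List.Membership.Propositional using (_∈_; _∉_)
open import Data.List.Membership.Propositional.Properties using (∈-map⁺; ∈-map⁻; ∈-++⁻; ∈-++⁺ˡ; ∈-++⁺ʳ; ∈-∃++; ∈-concat⁺′)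
open import Data.List.Relation.Unary.Any using (here; there)
open import Data.List.Relation.Unary.All using (All; []; _∷_; tabulate)
import Data.List.Relation.Unary.All as All
import Data.List.Relation.Unary.All.Properties as All
open import Data.List.Relation.Unary.AllPairs using ([]; _∷_)
open import Data.List.Relation.Unary.Unique.Propositional using (Unique)
open import Data.List.Relation.Unary.Unique.Propositional.Properties using (applyUpTo⁺₁; Unique[x∷xs]⇒x∉xs)
open import Data.List.Relation.Binary.Permutation.Propositional using (_↭_; prep; swap; ↭-refl; ↭-trans; ↭-sym; ↭⇒↭ₛ)
open import Data.List.Relation.Binary.Permutation.Propositional.Properties using (shift; ∈-resp-↭; ++-comm; ++⁺ˡ; drop-mid; filter-↭; ↭-empty-inv; ↭-length) renaming (map⁺ to ↭-map⁺; ++⁺ to ↭-++⁺)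
open import Data.List.Relation.Binary.Permutation.Setoid.Properties using (Unique-resp-↭)
open import Data.Product using (_×_; _,_; ∃-syntax; proj₁; proj₂)
open import Data.Sum using (_⊎_; inj₁; inj₂)
open import Data.Empty using (⊥; ⊥-elim)
open import Data.Unit using (⊤; tt)
open import Relation.Binary.PropositionalEquality
open import Relation.Nullary using (¬_; yes; no)
open import Relation.Nullary.Decidable using (_×-dec_)
open import Relation.Binary.Definitions using (tri<; tri≈; tri>)
open import Relation.Unary using () renaming (Decidable to Decidable₁)

record Parametrizes {T X : Set} (P : T → Set) (e : T → X) (A : X → Set) : Set where
  field
    sound    : ∀ t → P t → A (e t)
    complete : ∀ x → A x → ∃[ t ] (P t × x ≡ e t)

open Parametrizes

transport : {T X Y : Set} {P : T → Set} {A : X → Set} {B : Y → Set} {e : T → X} {d : T → Y} (f : X → Y) →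
  Parametrizes P e A → Parametrizes P d B → (∀ t → f (e t) ≡ d t) →
  (∀ {t t'} → d t ≡ d t' → t ≡ t') → BijOnto A B f
transport {B = B} {e = e} {d = d} f pA pB f∘e d-inj = record
  { maps-to = λ x ax → let (t , pt , x≡et) = complete pA x ax in
      subst B (sym (trans (cong f x≡et) (f∘e t))) (sound pB t pt)
  ; injective = λ x x' ax ax' fx≡fx' →
      let (t , _ , x≡et) = complete pA x ax
          (t' , _ , x'≡et') = complete pA x' ax'
          dt≡dt' = trans (sym (f∘e t)) (trans (cong f (sym x≡et)) (trans fx≡fx' (trans (cong f x'≡et') (f∘e t'))))
      in trans x≡et (trans (cong e (d-inj dt≡dt')) (sym x'≡et'))
  ; surjective = λ y by → let (t , pt , y≡dt) = complete pB y by in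
      e t , sound pA t pt , trans (f∘e t) (sym y≡dt)
  }

≡ᵇ-refl : ∀ x → (x ≡ᵇ x) ≡ true
≡ᵇ-refl zero = refl
≡ᵇ-refl (suc x) = ≡ᵇ-refl x

≢⇒≡ᵇ-false : ∀ {x y} → ¬ x ≡ y → (x ≡ᵇ y) ≡ false
≢⇒≡ᵇ-false {x} {y} ne with x ≡ᵇ y in e
... | true = ⊥-elim (ne (≡ᵇ⇒≡ x y (subst T (sym e) tt)))
... | false = refl

<ᵇ-true⇒< : ∀ {x y} → (x <ᵇ y) ≡ true → x < y
<ᵇ-true⇒< {x} {y} e = <ᵇ⇒< x y (subst T (sym e) tt)

≮⇒<ᵇ-false : ∀ {x y} → ¬ x < y → (x <ᵇ y) ≡ false
≮⇒<ᵇ-false {x} {y} ne with x <ᵇ y in e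
... | true = ⊥-elim (ne (<ᵇ-true⇒< e))
... | false = refl

≡ᵇ-+ : ∀ c x y → (c + x ≡ᵇ c + y) ≡ (x ≡ᵇ y)
≡ᵇ-+ zero x y = refl
≡ᵇ-+ (suc c) x y = ≡ᵇ-+ c x y

<ᵇ-+ : ∀ c x y → (c + x <ᵇ c + y) ≡ (x <ᵇ y)
<ᵇ-+ zero x y = refl
<ᵇ-+ (suc c) x y = <ᵇ-+ c x y

above : ∀ k x → k < x → ∃[ x' ] (x ≡ k + x' × 1 ≤ x')
above k x k<x = x ∸ k , sym (m+[n∸m]≡n (<⇒≤ k<x)) , m<n⇒0<n∸m k<x

-- Every decomposition of a tree into
-- subtrees places their codes into consecutive blocks of values, so these
-- block decompositions of [1‥ n] are used throughout.

sh : ℕ → List ℕ → List ℕ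
sh c = map (c +_)

sh-sh : ∀ a b L → sh a (sh b L) ≡ sh (a + b) L
sh-sh a b [] = refl
sh-sh a b (x ∷ L) = cong₂ _∷_ (sym (+-assoc a b x)) (sh-sh a b L)

length-sh : ∀ c L → length (sh c L) ≡ length L
length-sh c L = length-map (c +_) L

[1‥suc] : ∀ n → [1‥ suc n ] ≡ 1 ∷ sh 1 [1‥ n ]
[1‥suc] n = cong (1 ∷_) (sym (map-applyUpTo suc (1 +_) n))

[1‥+] : ∀ a b → [1‥ a + b ] ≡ [1‥ a ] ++ sh a [1‥ b ]
[1‥+] zero b = sym (map-id [1‥ b ])
[1‥+] (suc a) b = begin
    [1‥ suc (a + b) ]                        ≡⟨ [1‥suc] (a + b) ⟩
    1 ∷ sh 1 [1‥ a + b ]                     ≡⟨ cong (λ z → 1 ∷ sh 1 z) ([1‥+] a b) ⟩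
    1 ∷ sh 1 ([1‥ a ] ++ sh a [1‥ b ])       ≡⟨ cong (1 ∷_) (map-++ (1 +_) [1‥ a ] (sh a [1‥ b ])) ⟩
    1 ∷ sh 1 [1‥ a ] ++ sh 1 (sh a [1‥ b ])  ≡⟨ cong (λ z → 1 ∷ sh 1 [1‥ a ] ++ z) (sh-sh 1 a _) ⟩
    1 ∷ sh 1 [1‥ a ] ++ sh (suc a) [1‥ b ]   ≡⟨ cong (_++ sh (suc a) [1‥ b ]) (sym ([1‥suc] a)) ⟩
    [1‥ suc a ] ++ sh (suc a) [1‥ b ]        ∎
  where open ≡-Reasoning

[1‥snoc] : ∀ n → [1‥ suc n ] ≡ [1‥ n ] ++ suc n ∷ []
[1‥snoc] n = sym (applyUpTo-∷ʳ suc n)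

[1‥arch] : ∀ j m → [1‥ suc (suc j) + m ] ≡ 1 ∷ sh 1 [1‥ j ] ++ suc (suc j) ∷ sh (suc (suc j)) [1‥ m ]
[1‥arch] j m = begin
    [1‥ suc (suc j) + m ]                       ≡⟨ [1‥+] (suc (suc j)) m ⟩
    [1‥ suc (suc j) ] ++ Y                      ≡⟨ cong (_++ Y) ([1‥suc] (suc j)) ⟩
    1 ∷ sh 1 [1‥ suc j ] ++ Y                   ≡⟨ cong (λ z → 1 ∷ sh 1 z ++ Y) ([1‥snoc] j) ⟩
    1 ∷ sh 1 ([1‥ j ] ++ suc j ∷ []) ++ Y       ≡⟨ cong (λ z → 1 ∷ z ++ Y) (map-++ (1 +_) [1‥ j ] _) ⟩
    1 ∷ (sh 1 [1‥ j ] ++ suc (suc j) ∷ []) ++ Y ≡⟨ cong (1 ∷_) (++-assoc (sh 1 [1‥ j ]) _ Y) ⟩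
    1 ∷ sh 1 [1‥ j ] ++ suc (suc j) ∷ Y         ∎
  where
  open ≡-Reasoning
  Y = sh (suc (suc j)) [1‥ m ]

length-[1‥] : ∀ n → length [1‥ n ] ≡ n
length-[1‥] n = length-applyUpTo suc n

∈[1‥]⇒range : ∀ n {x} → x ∈ [1‥ n ] → 1 ≤ x × x ≤ n
∈[1‥]⇒range (suc n) p rewrite [1‥suc] n with p
... | here refl = s≤s z≤n , s≤s z≤n
... | there q with ∈-map⁻ (1 +_) q
... | y , r , refl = s≤s z≤n , s≤s (proj₂ (∈[1‥]⇒range n r))

range⇒∈[1‥] : ∀ n {x} → 1 ≤ x → x ≤ n → x ∈ [1‥ n ]
range⇒∈[1‥] (suc n) {suc zero} _ _ rewrite [1‥suc] n = here refl
range⇒∈[1‥] (suc n) {suc (suc x)} _ (s≤s q) rewrite [1‥suc] n = there (∈-map⁺ (1 +_) (range⇒∈[1‥] n (s≤s z≤n) q))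

unique-[1‥] : ∀ n → Unique [1‥ n ]
unique-[1‥] n = applyUpTo⁺₁ suc n (λ i<j _ e → <⇒≢ i<j (suc-injective e))

val-zero : ∀ xs → val xs 0 ≡ 0
val-zero [] = refl
val-zero (x ∷ xs) = refl

val-++ˡ : ∀ xs ys i → suc i ≤ length xs → val (xs ++ ys) (suc i) ≡ val xs (suc i)
val-++ˡ (x ∷ xs) ys zero _ = refl
val-++ˡ (x ∷ xs) ys (suc i) (s≤s p) = val-++ˡ xs ys i p

val-++ʳ : ∀ xs ys i → val (xs ++ ys) (length xs + suc i) ≡ val ys (suc i)
val-++ʳ [] ys i = refl
val-++ʳ (x ∷ xs) ys i = begin
    val (x ∷ xs ++ ys) (suc (length xs + suc i)) ≡⟨ cong (λ z → val (x ∷ xs ++ ys) (suc z)) (+-suc (length xs) i) ⟩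
    val (xs ++ ys) (suc (length xs + i))         ≡⟨ cong (val (xs ++ ys)) (sym (+-suc (length xs) i)) ⟩
    val (xs ++ ys) (length xs + suc i)           ≡⟨ val-++ʳ xs ys i ⟩
    val ys (suc i)                               ∎
  where open ≡-Reasoning

val-map : ∀ (f : ℕ → ℕ) L i → 1 ≤ i → i ≤ length L → val (map f L) i ≡ f (val L i)
val-map f (x ∷ L) (suc zero) _ _ = refl
val-map f (x ∷ L) (suc (suc i)) _ (s≤s q) = val-map f L (suc i) (s≤s z≤n) q

val-∈ : ∀ xs i → suc i ≤ length xs → val xs (suc i) ∈ xs
val-∈ (x ∷ xs) zero _ = here refl
val-∈ (x ∷ xs) (suc i) (s≤s p) = there (val-∈ xs i p)

val-out : ∀ xs i → length xs < i → val xs i ≡ 0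
val-out [] i _ = refl
val-out (x ∷ xs) (suc (suc i)) (s≤s p) = val-out xs (suc i) p

pos-++ˡ : ∀ A B x → x ∈ A → pos (A ++ B) x ≡ pos A x
pos-++ˡ (a ∷ A) B x (here refl) rewrite ≡ᵇ-refl a = refl
pos-++ˡ (a ∷ A) B x (there m) with a ≡ᵇ x
... | true = refl
... | false = cong suc (pos-++ˡ A B x m)

pos-++ʳ : ∀ A B x → x ∉ A → pos (A ++ B) x ≡ length A + pos B x
pos-++ʳ [] B x _ = refl
pos-++ʳ (a ∷ A) B x x∉ rewrite ≢⇒≡ᵇ-false (λ e → x∉ (here (sym e))) = cong suc (pos-++ʳ A B x (λ m → x∉ (there m)))

pos-sh : ∀ c A x → pos (sh c A) (c + x) ≡ pos A x
pos-sh c [] x = refl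
pos-sh c (a ∷ A) x rewrite ≡ᵇ-+ c a x with a ≡ᵇ x
... | true = refl
... | false = cong suc (pos-sh c A x)

pos-≤ : ∀ A x → x ∈ A → pos A x ≤ length A
pos-≤ (a ∷ A) x (here refl) rewrite ≡ᵇ-refl a = s≤s z≤n
pos-≤ (a ∷ A) x (there m) with a ≡ᵇ x
... | true = s≤s z≤n
... | false = s≤s (pos-≤ A x m)

-- Subsequences.  The empty list is a subsequence of every list, which lets
-- occurrences of patterns be taken apart by plain pattern matching.

infix 4 _⊑_
data _⊑_ : List ℕ → List ℕ → Set where
  nil : ∀ {ys} → [] ⊑ ys
  skip : ∀ {xs y ys} → xs ⊑ ys → xs ⊑ (y ∷ ys)
  keep : ∀ {x xs ys} → xs ⊑ ys → (x ∷ xs) ⊑ (x ∷ ys)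

⊑-refl : ∀ xs → xs ⊑ xs
⊑-refl [] = nil
⊑-refl (x ∷ xs) = keep (⊑-refl xs)

⊑-trans : ∀ {xs ys zs} → xs ⊑ ys → ys ⊑ zs → xs ⊑ zs
⊑-trans p (skip q) = skip (⊑-trans p q)
⊑-trans nil q = nil
⊑-trans (skip p) (keep q) = skip (⊑-trans p q)
⊑-trans (keep p) (keep q) = keep (⊑-trans p q)

⊑-++ʳ : ∀ {xs} A {B} → xs ⊑ B → xs ⊑ A ++ B
⊑-++ʳ [] p = p
⊑-++ʳ (a ∷ A) p = skip (⊑-++ʳ A p)

⊑-++ : ∀ {xs ys A B} → xs ⊑ A → ys ⊑ B → xs ++ ys ⊑ A ++ B
⊑-++ {A = A} nil q = ⊑-++ʳ A q
⊑-++ (skip p) q = skip (⊑-++ p q)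
⊑-++ (keep p) q = keep (⊑-++ p q)

⊑-++ˡ : ∀ {xs A} B → xs ⊑ A → xs ⊑ A ++ B
⊑-++ˡ {xs} B p = subst (_⊑ _) (++-identityʳ xs) (⊑-++ p (nil {B}))

⊑-split : ∀ {zs} A B → zs ⊑ A ++ B → ∃[ z1 ] ∃[ z2 ] (zs ≡ z1 ++ z2 × z1 ⊑ A × z2 ⊑ B)
⊑-split [] B p = [] , _ , refl , nil , p
⊑-split (a ∷ A) B nil = [] , [] , refl , nil , nil
⊑-split (a ∷ A) B (skip p) with ⊑-split A B p
... | z1 , z2 , e , q , r = z1 , z2 , e , skip q , r
⊑-split (a ∷ A) B (keep p) with ⊑-split A B p
... | z1 , z2 , refl , q , r = a ∷ z1 , z2 , refl , keep q , r

⊑-sh⁻ : ∀ c {zs} A → zs ⊑ sh c A → ∃[ z ] (zs ≡ sh c z × z ⊑ A)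
⊑-sh⁻ c [] nil = [] , refl , nil
⊑-sh⁻ c (a ∷ A) nil = [] , refl , nil
⊑-sh⁻ c (a ∷ A) (skip p) with ⊑-sh⁻ c A p
... | z , e , q = z , e , skip q
⊑-sh⁻ c (a ∷ A) (keep p) with ⊑-sh⁻ c A p
... | z , refl , q = a ∷ z , refl , keep q

⊑-sh⁺ : ∀ c {zs A} → zs ⊑ A → sh c zs ⊑ sh c A
⊑-sh⁺ c nil = nil
⊑-sh⁺ c (skip p) = skip (⊑-sh⁺ c p)
⊑-sh⁺ c (keep p) = keep (⊑-sh⁺ c p)

⊑-All : ∀ {P : ℕ → Set} {zs A} → zs ⊑ A → All P A → All P zs
⊑-All nil _ = []
⊑-All (skip p) (_ ∷ q) = ⊑-All p q
⊑-All (keep p) (x ∷ q) = x ∷ ⊑-All p q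

∈⇒⊑ : ∀ {y L} → y ∈ L → (y ∷ []) ⊑ L
∈⇒⊑ (here refl) = keep nil
∈⇒⊑ (there m) = skip (∈⇒⊑ m)

-- Subsequences of w are exactly the lists  map (val w) ps  for strictly
-- increasing position lists ps within 1‥length w.  This translates the
-- index-based definitions of pattern containment into subsequences.

data Ascending : ℕ → List ℕ → Set where
  []  : ∀ {lo} → Ascending lo []
  _∷_ : ∀ {lo p ps} → lo < p → Ascending p ps → Ascending lo (p ∷ ps)

Ascending-suc : ∀ {lo ps} → Ascending lo ps → Ascending (suc lo) (map suc ps)
Ascending-suc [] = []
Ascending-suc (x ∷ i) = s≤s x ∷ Ascending-suc i

Ascending-pred : ∀ {lo ps} → Ascending (suc lo) ps → Ascending lo (map pred ps)
Ascending-pred [] = []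
Ascending-pred {ps = suc p ∷ _} (s≤s x ∷ i) = x ∷ Ascending-pred i

Ascending-weaken : ∀ {lo lo' ps} → lo' ≤ lo → Ascending lo ps → Ascending lo' ps
Ascending-weaken q [] = []
Ascending-weaken q (x ∷ i) = ≤-<-trans q x ∷ i

Ascending-above : ∀ {lo ps} → Ascending lo ps → All (lo <_) ps
Ascending-above [] = []
Ascending-above (x ∷ i) = x ∷ All.map (<-trans x) (Ascending-above i)

All-suc≤ : ∀ {n ps} → All (_≤ n) ps → All (_≤ suc n) (map suc ps)
All-suc≤ [] = []
All-suc≤ (x ∷ a) = s≤s x ∷ All-suc≤ a

All-pred≤ : ∀ {n ps} → All (_≤ suc n) ps → All (_≤ n) (map pred ps)
All-pred≤ [] = []
All-pred≤ {ps = zero ∷ _} (x ∷ a) = z≤n ∷ All-pred≤ a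
All-pred≤ {ps = suc p ∷ _} (s≤s x ∷ a) = x ∷ All-pred≤ a

map-val-suc : ∀ y w ps → All (0 <_) ps → map (val (y ∷ w)) (map suc ps) ≡ map (val w) ps
map-val-suc y w [] _ = refl
map-val-suc y w (suc p ∷ ps) (_ ∷ a) = cong (val w (suc p) ∷_) (map-val-suc y w ps a)

map-val-pred : ∀ y w ps → All (1 <_) ps → map (val w) (map pred ps) ≡ map (val (y ∷ w)) ps
map-val-pred y w [] _ = refl
map-val-pred y w (suc zero ∷ ps) (s≤s () ∷ a)
map-val-pred y w (suc (suc p) ∷ ps) (_ ∷ a) = cong (val w (suc p) ∷_) (map-val-pred y w ps a)

⊑⇒positions : ∀ {zs} w → zs ⊑ w → ∃[ ps ] (Ascending 0 ps × All (_≤ length w) ps × map (val w) ps ≡ zs)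
⊑⇒positions w nil = [] , [] , [] , refl
⊑⇒positions (y ∷ w) (skip p) with ⊑⇒positions w p
... | ps , asc , bd , e = map suc ps , Ascending-weaken z≤n (Ascending-suc asc) , All-suc≤ bd ,
    trans (map-val-suc y w ps (Ascending-above asc)) e
⊑⇒positions (y ∷ w) (keep p) with ⊑⇒positions w p
... | ps , asc , bd , e = 1 ∷ map suc ps , s≤s z≤n ∷ Ascending-suc asc , s≤s z≤n ∷ All-suc≤ bd ,
    cong (y ∷_) (trans (map-val-suc y w ps (Ascending-above asc)) e)

positions⇒⊑ : ∀ w ps → Ascending 0 ps → All (_≤ length w) ps → map (val w) ps ⊑ w
positions⇒⊑ w [] _ _ = nil
positions⇒⊑ [] (p ∷ ps) (s≤s x ∷ _) (() ∷ _)
positions⇒⊑ (y ∷ w) (suc zero ∷ ps) (_ ∷ asc) (_ ∷ bd) =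
  keep (subst (_⊑ w) (map-val-pred y w ps (Ascending-above asc))
         (positions⇒⊑ w (map pred ps) (Ascending-pred asc) (All-pred≤ bd)))
positions⇒⊑ (y ∷ w) (suc (suc p) ∷ ps) (_ ∷ asc) bd =
  skip (subst (_⊑ w) (map-val-pred y w (suc (suc p) ∷ ps) (s≤s (s≤s z≤n) ∷ Ascending-above (Ascending-weaken (s≤s z≤n) asc)))
         (positions⇒⊑ w (map pred (suc (suc p) ∷ ps)) (s≤s z≤n ∷ Ascending-pred asc) (All-pred≤ bd)))

Pat3412 : List ℕ → Set
Pat3412 w = ∃[ a ] ∃[ b ] ∃[ c ] ∃[ d ] ((a ∷ b ∷ c ∷ d ∷ []) ⊑ w × c < d × d < a × a < b)

Pat132 : List ℕ → Set
Pat132 w = ∃[ a ] ∃[ b ] ∃[ c ] ((a ∷ b ∷ c ∷ []) ⊑ w × a < c × c < b)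

C123 : List ℕ → Set
C123 (x ∷ y ∷ z ∷ r) = (x < y × y < z) ⊎ C123 (y ∷ z ∷ r)
C123 _ = ⊥

Contains3412⇒Pat : ∀ w → Contains3412 w → Pat3412 w
Contains3412⇒Pat w (i , j , k , l , 1≤i , i<j , j<k , k<l , l≤n , v1 , v2 , v3) =
  val w i , val w j , val w k , val w l ,
  positions⇒⊑ w (i ∷ j ∷ k ∷ l ∷ []) (1≤i ∷ i<j ∷ j<k ∷ k<l ∷ [])
    (≤-trans (<⇒≤ i<j) k≤n ∷ k≤n ∷ ≤-trans (<⇒≤ k<l) l≤n ∷ l≤n ∷ []) ,
  v1 , v2 , v3
  where
  k≤n = ≤-trans (<⇒≤ j<k) (≤-trans (<⇒≤ k<l) l≤n)

Pat3412⇒Contains : ∀ w → Pat3412 w → Contains3412 w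
Pat3412⇒Contains w (a , b , c , d , s , v1 , v2 , v3) with ⊑⇒positions w s
... | i ∷ j ∷ k ∷ l ∷ [] , 1≤i ∷ i<j ∷ j<k ∷ k<l ∷ [] , _ ∷ _ ∷ _ ∷ l≤n ∷ [] , refl =
  i , j , k , l , 1≤i , i<j , j<k , k<l , l≤n , v1 , v2 , v3

Contains132⇒Pat : ∀ w → Contains132 w → Pat132 w
Contains132⇒Pat w (i , j , k , 1≤i , i<j , j<k , k≤n , v1 , v2) =
  val w i , val w j , val w k ,
  positions⇒⊑ w (i ∷ j ∷ k ∷ []) (1≤i ∷ i<j ∷ j<k ∷ [])
    (≤-trans (<⇒≤ i<j) j≤n ∷ j≤n ∷ k≤n ∷ []) ,
  v1 , v2
  where
  j≤n = ≤-trans (<⇒≤ j<k) k≤n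

Pat132⇒Contains : ∀ w → Pat132 w → Contains132 w
Pat132⇒Contains w (a , b , c , s , v1 , v2) with ⊑⇒positions w s
... | i ∷ j ∷ k ∷ [] , 1≤i ∷ i<j ∷ j<k ∷ [] , _ ∷ _ ∷ k≤n ∷ [] , refl =
  i , j , k , 1≤i , i<j , j<k , k≤n , v1 , v2

ContainsCons123⇒C123 : ∀ w → ContainsCons123 w → C123 w
ContainsCons123⇒C123 (x ∷ y ∷ z ∷ r) (suc zero , _ , _ , v1 , v2) = inj₁ (v1 , v2)
ContainsCons123⇒C123 (x ∷ y ∷ z ∷ r) (suc (suc i) , _ , s≤s p , v1 , v2) =
  inj₂ (ContainsCons123⇒C123 (y ∷ z ∷ r) (suc i , s≤s z≤n , p , v1 , v2))
ContainsCons123⇒C123 (x ∷ y ∷ []) (suc zero , _ , s≤s (s≤s ()) , _)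
ContainsCons123⇒C123 (x ∷ y ∷ []) (suc (suc i) , _ , s≤s (s≤s ()) , _)
ContainsCons123⇒C123 (x ∷ []) (suc i , _ , s≤s () , _)

C123⇒ContainsCons123 : ∀ w → C123 w → ContainsCons123 w
C123⇒ContainsCons123 (x ∷ y ∷ z ∷ r) (inj₁ (v1 , v2)) = 1 , s≤s z≤n , s≤s (s≤s (s≤s z≤n)) , v1 , v2
C123⇒ContainsCons123 (x ∷ y ∷ z ∷ r) (inj₂ c) with C123⇒ContainsCons123 (y ∷ z ∷ r) c
... | suc i , _ , p , v1 , v2 = suc (suc i) , s≤s z≤n , s≤s p , v1 , v2

-- Motzkin trees: the first-return decomposition of Motzkin paths.  A path is
-- empty, or H followed by a path, or U a D b for paths a and b.

data MTree : Set where
  leaf  : MTree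
  hstep : MTree → MTree
  arch  : MTree → MTree → MTree

size : MTree → ℕ
size leaf = 0
size (hstep t) = suc (size t)
size (arch a b) = suc (suc (size a)) + size b

flat : MTree → List Step
flat leaf = []
flat (hstep t) = H ∷ flat t
flat (arch a b) = U ∷ flat a ++ D ∷ flat b

length-flat : ∀ t → length (flat t) ≡ size t
length-flat leaf = refl
length-flat (hstep t) = cong suc (length-flat t)
length-flat (arch a b) = cong suc (begin
    length (flat a ++ D ∷ flat b)     ≡⟨ length-++ (flat a) ⟩
    length (flat a) + suc (length (flat b)) ≡⟨ cong₂ (λ x y → x + suc y) (length-flat a) (length-flat b) ⟩
    size a + suc (size b)             ≡⟨ +-suc (size a) (size b) ⟩
    suc (size a + size b)             ∎)
  where open ≡-Reasoning

flat-arch-++ : ∀ a b s → flat (arch a b) ++ s ≡ U ∷ flat a ++ D ∷ flat b ++ s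
flat-arch-++ a b s = cong (U ∷_) (++-assoc (flat a) (D ∷ flat b) s)

MotzFrom-flat : ∀ t h s → MotzFrom h s → MotzFrom h (flat t ++ s)
MotzFrom-flat leaf h s m = m
MotzFrom-flat (hstep t) h s m = MotzFrom-flat t h s m
MotzFrom-flat (arch a b) h s m = subst (MotzFrom (suc h)) (sym (++-assoc (flat a) (D ∷ flat b) s))
  (MotzFrom-flat a (suc h) (D ∷ flat b ++ s) (MotzFrom-flat b h s m))

flat-Motzkin : ∀ t → MotzFrom 0 (flat t)
flat-Motzkin t = subst (MotzFrom 0) (++-identityʳ (flat t)) (MotzFrom-flat t 0 [] refl)

-- Parsing a path that starts at height h+1: it is a tree, the first step D
-- down to height h, and a remaining path.  The bound on the length is a fuel
-- argument making the recursion structural.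
parseReturn : ∀ bound h d → length d ≤ bound → MotzFrom (suc h) d →
  ∃[ t ] ∃[ r ] (d ≡ flat t ++ D ∷ r × MotzFrom h r × length r < length d)
parseReturn (suc bound) h (D ∷ d) (s≤s l) m = leaf , d , refl , m , ≤-refl
parseReturn (suc bound) h (H ∷ d) (s≤s l) m with parseReturn bound h d l m
... | t , r , refl , m' , lt = hstep t , r , refl , m' , m≤n⇒m≤1+n lt
parseReturn (suc bound) h (U ∷ d) (s≤s l) m with parseReturn bound (suc h) d l m
... | t1 , r1 , refl , m1 , lt1 with parseReturn bound h r1 (≤-trans (<⇒≤ lt1) l) m1
... | t2 , r , refl , m2 , lt2 = arch t1 t2 , r , sym (flat-arch-++ t1 t2 (D ∷ r)) , m2 , m≤n⇒m≤1+n (<-trans lt2 lt1)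

parse : ∀ bound d → length d ≤ bound → MotzFrom 0 d → ∃[ t ] (d ≡ flat t)
parse bound [] _ _ = leaf , refl
parse (suc bound) (H ∷ d) (s≤s l) m with parse bound d l m
... | t , refl = hstep t , refl
parse (suc bound) (U ∷ d) (s≤s l) m with parseReturn bound 0 d l m
... | t1 , r , refl , m1 , lt with parse bound r (≤-trans (<⇒≤ lt) l) m1
... | t2 , refl = arch t1 t2 , refl

flat-D-injective : ∀ t t' s s' → flat t ++ D ∷ s ≡ flat t' ++ D ∷ s' → t ≡ t' × s ≡ s'
flat-D-injective leaf leaf s s' refl = refl , refl
flat-D-injective (hstep t) (hstep t') s s' e with flat-D-injective t t' s s' (∷-injectiveʳ e)
... | refl , refl = refl , refl
flat-D-injective (arch a b) (arch a' b') s s' e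
  with flat-D-injective a a' (flat b ++ D ∷ s) (flat b' ++ D ∷ s')
         (∷-injectiveʳ (trans (sym (flat-arch-++ a b (D ∷ s))) (trans e (flat-arch-++ a' b' (D ∷ s')))))
... | refl , e' with flat-D-injective b b' s s' e'
... | refl , refl = refl , refl
flat-D-injective leaf (hstep t') s s' ()
flat-D-injective leaf (arch a' b') s s' ()
flat-D-injective (hstep t) leaf s s' ()
flat-D-injective (arch a b) leaf s s' ()
flat-D-injective (hstep t) (arch a' b') s s' ()
flat-D-injective (arch a b) (hstep t') s s' ()

motz : MTree → List Step × List ℕ
motz t = flat t , replicate (size t) 0

motz-injective : ∀ {t t'} → motz t ≡ motz t' → t ≡ t'
motz-injective {t} {t'} e = proj₁ (flat-D-injective t t' [] [] (cong (λ p → proj₁ p ++ D ∷ []) e))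

motz-param : ∀ n → Parametrizes (λ t → size t ≡ n) motz (MotzZero n)
motz-param n = record { sound = sound′ ; complete = complete′ }
  where
  sound′ : ∀ t → size t ≡ n → MotzZero n (motz t)
  sound′ t refl = (length-flat t , flat-Motzkin t) , refl
  complete′ : ∀ y → MotzZero n y → ∃[ t ] (size t ≡ n × y ≡ motz t)
  complete′ (d , _) ((refl , md) , refl) with parse (length d) d ≤-refl md
  ... | t , refl = t , sym (length-flat t) , cong (λ m → flat t , replicate m 0) (length-flat t)

sh-above : ∀ c {L} → All (λ x → 1 ≤ x) L → All (c <_) (sh c L)
sh-above c al = All.map⁺ (All.map (λ {x} 1≤x → subst (_≤ c + x) (+-comm c 1) (+-monoʳ-≤ c 1≤x)) al)

sh-below : ∀ c {m L} → All (_≤ m) L → All (_≤ c + m) (sh c L)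
sh-below c al = All.map⁺ (All.map (+-monoʳ-≤ c) al)

-- The codes of trees are concatenations of such
-- blocks, and most properties are transferred blockwise.

Agrees : List ℕ → ℕ → List ℕ → ℕ → Set
Agrees w c v m = ∀ i → 1 ≤ i → i ≤ m → val w (c + i) ≡ c + val v i

agrees-middle : ∀ X v Y → Agrees (X ++ sh (length X) v ++ Y) (length X) v (length v)
agrees-middle X v Y (suc i) _ le = begin
    val (X ++ sh c v ++ Y) (c + suc i) ≡⟨ val-++ʳ X (sh c v ++ Y) i ⟩
    val (sh c v ++ Y) (suc i)          ≡⟨ val-++ˡ (sh c v) Y i (subst (suc i ≤_) (sym (length-sh c v)) le) ⟩
    val (sh c v) (suc i)               ≡⟨ val-map (c +_) v (suc i) (s≤s z≤n) le ⟩
    c + val v (suc i)                  ∎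
  where
  open ≡-Reasoning
  c = length X

involutive-in-block : ∀ w c v {m} → Agrees w c v m → ∀ i → 1 ≤ i → i ≤ m →
  1 ≤ val v i → val v i ≤ m → val v (val v i) ≡ i → val w (val w (c + i)) ≡ c + i
involutive-in-block w c v ag i p q r1 r2 iv = begin
    val w (val w (c + i))  ≡⟨ cong (val w) (ag i p q) ⟩
    val w (c + val v i)    ≡⟨ ag (val v i) r1 r2 ⟩
    c + val v (val v i)    ≡⟨ cong (c +_) iv ⟩
    c + i                  ∎
  where open ≡-Reasoning

crossing-in-block : ∀ w c v {m} → Agrees w c v m → ∀ i x → 1 ≤ i → i ≤ m → 1 ≤ val v i →
  val w (c + i) < x → x < c + i → c + i < val w x →
  ∃[ x' ] (val v i < x' × x' < i × i < val v x')
crossing-in-block w c v ag i x p q r wi<x x<i i<wx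
  with above c x (≤-<-trans (m≤m+n c (val v i)) (subst (_< x) (ag i p q) wi<x))
... | x' , refl , _ = x' , vi<x' , x'<i , +-cancelˡ-< c i (val v x') (subst (c + i <_) (ag x' 1≤x' x'≤m) i<wx)
  where
  vi<x' = +-cancelˡ-< c (val v i) x' (subst (_< c + x') (ag i p q) wi<x)
  x'<i = +-cancelˡ-< c x' i x<i
  1≤x' = ≤-trans r (<⇒≤ vi<x')
  x'≤m = ≤-trans (<⇒≤ x'<i) q

data HPosition (m : ℕ) : ℕ → Set where
  first : HPosition m 1
  inner : ∀ i → 1 ≤ i → i ≤ m → HPosition m (suc i)

hPosition : ∀ m i → 1 ≤ i → i ≤ suc m → HPosition m i
hPosition m (suc zero) _ _ = first
hPosition m (suc (suc i)) _ (s≤s le) = inner (suc i) (s≤s z≤n) le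

data ArchPosition (j m : ℕ) : ℕ → Set where
  first : ArchPosition j m 1
  inner : ∀ i → 1 ≤ i → i ≤ j → ArchPosition j m (suc i)
  close : ArchPosition j m (suc (suc j))
  outer : ∀ i → 1 ≤ i → i ≤ m → ArchPosition j m (suc (suc j) + i)

archPosition : ∀ j m i → 1 ≤ i → i ≤ suc (suc j) + m → ArchPosition j m i
archPosition j m (suc zero) _ _ = first
archPosition j m (suc (suc i)) _ le with suc i ≤? j
... | yes i<j = inner (suc i) (s≤s z≤n) i<j
... | no i≮j with i ≟ j
... | yes refl = close
... | no i≢j with above j i (≤∧≢⇒< (≤-pred (≰⇒> i≮j)) (λ e → i≢j (sym e)))
... | i' , refl , 1≤i' = outer i' 1≤i' (+-cancelˡ-≤ (suc (suc j)) i' m le)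

inv : MTree → List ℕ
inv leaf = []
inv (hstep t) = 1 ∷ sh 1 (inv t)
inv (arch a b) = suc (suc (size a)) ∷ sh 1 (inv a) ++ 1 ∷ sh (suc (suc (size a))) (inv b)

length-inv : ∀ t → length (inv t) ≡ size t
length-inv leaf = refl
length-inv (hstep t) = cong suc (trans (length-sh 1 (inv t)) (length-inv t))
length-inv (arch a b) = cong suc (begin
    length (sh 1 (inv a) ++ 1 ∷ sh k (inv b))        ≡⟨ length-++ (sh 1 (inv a)) ⟩
    length (sh 1 (inv a)) + suc (length (sh k (inv b))) ≡⟨ cong₂ (λ x y → x + suc y) (trans (length-sh 1 (inv a)) (length-inv a))
                                                                                      (trans (length-sh k (inv b)) (length-inv b)) ⟩
    size a + suc (size b)                            ≡⟨ +-suc (size a) (size b) ⟩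
    suc (size a + size b)                            ∎)
  where
  open ≡-Reasoning
  k = suc (suc (size a))

inv-perm : ∀ t → inv t ↭ [1‥ size t ]
inv-perm leaf = ↭-refl
inv-perm (hstep t) = subst (inv (hstep t) ↭_) (sym ([1‥suc] (size t))) (prep 1 (↭-map⁺ (1 +_) (inv-perm t)))
inv-perm (arch a b) = subst (inv (arch a b) ↭_) (sym ([1‥arch] (size a) (size b)))
  (↭-trans (prep k (↭-++⁺ (↭-map⁺ (1 +_) (inv-perm a)) (prep 1 (↭-map⁺ (k +_) (inv-perm b)))))
  (↭-trans (↭-sym (shift k X (1 ∷ Y)))
  (↭-trans (++⁺ˡ X (swap k 1 ↭-refl))
  (shift 1 X (k ∷ Y)))))
  where
  k = suc (suc (size a))
  X = sh 1 [1‥ size a ]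
  Y = sh k [1‥ size b ]

inv-range : ∀ t {x} → x ∈ inv t → 1 ≤ x × x ≤ size t
inv-range t m = ∈[1‥]⇒range (size t) (∈-resp-↭ (inv-perm t) m)

inv-range-All : ∀ t → All (λ x → 1 ≤ x × x ≤ size t) (inv t)
inv-range-All t = tabulate (inv-range t)

inv-val-range : ∀ t i → 1 ≤ i → i ≤ size t → 1 ≤ val (inv t) i × val (inv t) i ≤ size t
inv-val-range t (suc i) _ le = inv-range t (val-∈ (inv t) i (subst (suc i ≤_) (sym (length-inv t)) le))

-- Out of range, val returns the junk value 0.
inv-val-≤ : ∀ t i → val (inv t) i ≤ size t
inv-val-≤ t zero = subst (_≤ size t) (sym (val-zero (inv t))) z≤n
inv-val-≤ t (suc i) with suc i ≤? size t
... | yes le = proj₂ (inv-val-range t (suc i) (s≤s z≤n) le)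
... | no gt = subst (_≤ size t) (sym (val-out (inv t) (suc i) (subst (_< suc i) (sym (length-inv t)) (≰⇒> gt)))) z≤n

agrees-hstep : ∀ t → Agrees (inv (hstep t)) 1 (inv t) (size t)
agrees-hstep t = subst₂ (λ w m → Agrees w 1 (inv t) m) (cong (1 ∷_) (++-identityʳ _)) (length-inv t)
  (agrees-middle (1 ∷ []) (inv t) [])

agrees-inner : ∀ a b → Agrees (inv (arch a b)) 1 (inv a) (size a)
agrees-inner a b = subst (Agrees (inv (arch a b)) 1 (inv a)) (length-inv a)
  (agrees-middle (suc (suc (size a)) ∷ []) (inv a) (1 ∷ sh (suc (suc (size a))) (inv b)))

inner-part : MTree → List ℕ
inner-part a = suc (suc (size a)) ∷ sh 1 (inv a) ++ 1 ∷ []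

length-inner-part : ∀ a → length (inner-part a) ≡ suc (suc (size a))
length-inner-part a = cong suc (begin
    length (sh 1 (inv a) ++ 1 ∷ []) ≡⟨ length-++ (sh 1 (inv a)) ⟩
    length (sh 1 (inv a)) + 1      ≡⟨ cong (_+ 1) (trans (length-sh 1 (inv a)) (length-inv a)) ⟩
    size a + 1                     ≡⟨ +-comm (size a) 1 ⟩
    suc (size a)                   ∎)
  where open ≡-Reasoning

inv-arch-split : ∀ a b → inv (arch a b) ≡ inner-part a ++ sh (suc (suc (size a))) (inv b)
inv-arch-split a b = cong (suc (suc (size a)) ∷_) (sym (++-assoc (sh 1 (inv a)) (1 ∷ []) _))

agrees-outer : ∀ a b → Agrees (inv (arch a b)) (suc (suc (size a))) (inv b) (size b)
agrees-outer a b = subst₂ (λ w m → Agrees w k (inv b) m) (sym (inv-arch-split a b)) (length-inv b)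
  (subst (λ c → Agrees (inner-part a ++ sh k (inv b)) c (inv b) (length (inv b))) (length-inner-part a)
    (subst (λ X → Agrees X (length (inner-part a)) (inv b) (length (inv b)))
      (cong (inner-part a ++_) (trans (cong (λ c → sh c (inv b) ++ []) (length-inner-part a)) (++-identityʳ _)))
      (agrees-middle (inner-part a) (inv b) [])))
  where k = suc (suc (size a))

val-close : ∀ a b → val (inv (arch a b)) (suc (suc (size a))) ≡ 1
val-close a b = begin
    val w k                          ≡⟨ cong (val w) k≡ ⟩
    val ((k ∷ X) ++ Y) (length (k ∷ X) + 1) ≡⟨ val-++ʳ (k ∷ X) Y 0 ⟩
    1                                ∎
  where
  open ≡-Reasoning
  k = suc (suc (size a))
  w = inv (arch a b)
  X = sh 1 (inv a)
  Y = 1 ∷ sh k (inv b)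
  k≡ : k ≡ suc (length X + 1)
  k≡ = cong suc (trans (+-comm 1 (size a)) (cong (_+ 1) (sym (trans (length-sh 1 (inv a)) (length-inv a)))))

inv-involutive : ∀ t i → 1 ≤ i → i ≤ size t → val (inv t) (val (inv t) i) ≡ i
inv-involutive leaf (suc i) _ ()
inv-involutive (hstep t) i p q with hPosition (size t) i p q
... | first = refl
... | inner i' p' q' = let (r1 , r2) = inv-val-range t i' p' q' in
  involutive-in-block (inv (hstep t)) 1 (inv t) (agrees-hstep t) i' p' q' r1 r2 (inv-involutive t i' p' q')
inv-involutive (arch a b) i p q with archPosition (size a) (size b) i p q
... | first = val-close a b
... | close = cong (val (inv (arch a b))) (val-close a b)
... | inner i' p' q' = let (r1 , r2) = inv-val-range a i' p' q' in
  involutive-in-block (inv (arch a b)) 1 (inv a) (agrees-inner a b) i' p' q' r1 r2 (inv-involutive a i' p' q')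
... | outer i' p' q' = let (r1 , r2) = inv-val-range b i' p' q' in
  involutive-in-block (inv (arch a b)) (suc (suc (size a))) (inv b) (agrees-outer a b) i' p' q' r1 r2 (inv-involutive b i' p' q')

-- Non-crossing involutions: no two arcs (w i, i) and (x, w x) with
-- w i < x < i < w x.  This is what makes the labels of Ψ and Γ vanish.

NonCrossing : List ℕ → Set
NonCrossing w = ∀ i x → val w i < x → x < i → i < val w x → ⊥

inv-noncrossing-at : ∀ t i → 1 ≤ i → i ≤ size t → ∀ x →
  val (inv t) i < x → x < i → i < val (inv t) x → ⊥
inv-noncrossing-at leaf (suc i) _ ()
inv-noncrossing-at (hstep t) i p q x wi<x x<i i<wx with hPosition (size t) i p q
... | first = <⇒≱ x<i (≤-trans (s≤s z≤n) wi<x)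
... | inner i' p' q' with crossing-in-block (inv (hstep t)) 1 (inv t) (agrees-hstep t) i' x p' q' (proj₁ (inv-val-range t i' p' q')) wi<x x<i i<wx
... | x' , c1 , c2 , c3 = inv-noncrossing-at t i' p' q' x' c1 c2 c3
inv-noncrossing-at (arch a b) i p q x wi<x x<i i<wx with archPosition (size a) (size b) i p q
... | first = <⇒≱ x<i (≤-trans (s≤s z≤n) wi<x)
... | inner i' p' q' with crossing-in-block (inv (arch a b)) 1 (inv a) (agrees-inner a b) i' x p' q' (proj₁ (inv-val-range a i' p' q')) wi<x x<i i<wx
... | x' , c1 , c2 , c3 = inv-noncrossing-at a i' p' q' x' c1 c2 c3
inv-noncrossing-at (arch a b) i p q x wi<x x<i i<wx | outer i' p' q'
  with crossing-in-block (inv (arch a b)) (suc (suc (size a))) (inv b) (agrees-outer a b) i' x p' q' (proj₁ (inv-val-range b i' p' q')) wi<x x<i i<wx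
... | x' , c1 , c2 , c3 = inv-noncrossing-at b i' p' q' x' c1 c2 c3
-- The closing point k of the arch: x lies inside the arch, so w x < k.
inv-noncrossing-at (arch a b) i p q x wi<x x<i i<wx | close
  with above 1 x (subst (_< x) (val-close a b) wi<x)
... | x' , refl , 1≤x' = <⇒≱ i<wx (≤-trans wx≤j+1 (n≤1+n _))
  where
  x'≤j = ≤-pred (≤-pred x<i)
  wx≤j+1 : val (inv (arch a b)) (suc x') ≤ suc (size a)
  wx≤j+1 = subst (_≤ suc (size a)) (sym (agrees-inner a b x' 1≤x' x'≤j)) (s≤s (proj₂ (inv-val-range a x' 1≤x' x'≤j)))

-- The arcs of inv t do not cross; for i > size t, i < w x ≤ size t is impossible.
inv-noncrossing : ∀ t → NonCrossing (inv t)
inv-noncrossing t i x wi<x x<i i<wx with i ≤? size t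
... | yes le = inv-noncrossing-at t i (≤-trans (s≤s z≤n) x<i) le x wi<x x<i i<wx
... | no gt = <⇒≱ (<-trans (≰⇒> gt) i<wx) (inv-val-≤ t x)

3412-split : ∀ P Q m → All (_≤ m) P → All (m <_) Q → Pat3412 (P ++ Q) → Pat3412 P ⊎ Pat3412 Q
3412-split P Q m aP aQ (a , b , c , d , s , v1 , v2 , v3) with ⊑-split P Q s
... | [] , _ , refl , s1 , s2 = inj₂ (a , b , c , d , s2 , v1 , v2 , v3)
... | _ ∷ [] , _ , refl , s1 , s2 with ⊑-All s1 aP | ⊑-All s2 aQ
... | pa ∷ [] | _ ∷ pc ∷ _ ∷ [] = ⊥-elim (<⇒≱ (<-trans pc (<-trans v1 v2)) pa)
3412-split P Q m aP aQ (a , b , c , d , s , v1 , v2 , v3) | _ ∷ _ ∷ [] , _ , refl , s1 , s2 with ⊑-All s1 aP | ⊑-All s2 aQ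
... | pa ∷ _ | pc ∷ _ ∷ [] = ⊥-elim (<⇒≱ (<-trans pc (<-trans v1 v2)) pa)
3412-split P Q m aP aQ (a , b , c , d , s , v1 , v2 , v3) | _ ∷ _ ∷ _ ∷ [] , _ , refl , s1 , s2 with ⊑-All s1 aP | ⊑-All s2 aQ
... | pa ∷ _ | pd ∷ [] = ⊥-elim (<⇒≱ (<-trans pd v2) pa)
3412-split P Q m aP aQ (a , b , c , d , s , v1 , v2 , v3) | _ ∷ _ ∷ _ ∷ _ ∷ [] , _ , refl , s1 , s2 =
  inj₁ (a , b , c , d , subst (_⊑ P) (sym (++-identityʳ _)) s1 , v1 , v2 , v3)
3412-split P Q m aP aQ (a , b , c , d , s , v1 , v2 , v3) | _ ∷ _ ∷ _ ∷ _ ∷ _ ∷ _ , _ , () , s1 , s2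

3412-drop-max-head : ∀ x X → All (_≤ x) X → Pat3412 (x ∷ X) → Pat3412 X
3412-drop-max-head x X al (a , b , c , d , skip s , v) = a , b , c , d , s , v
3412-drop-max-head x X al (a , b , c , d , keep s , v1 , v2 , v3) with ⊑-All s al
... | b≤a ∷ _ = ⊥-elim (<⇒≱ v3 b≤a)

3412-drop-min-last : ∀ X y → All (y ≤_) X → Pat3412 (X ++ y ∷ []) → Pat3412 X
3412-drop-min-last X y al (a , b , c , d , s , v1 , v2 , v3) with ⊑-split X (y ∷ []) s
... | _ ∷ _ ∷ _ ∷ _ ∷ [] , [] , refl , s1 , s2 = a , b , c , d , subst (_⊑ X) (sym (++-identityʳ _)) s1 , v1 , v2 , v3
... | _ ∷ _ ∷ _ ∷ [] , _ ∷ [] , refl , s1 , keep nil with ⊑-All s1 al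
... | _ ∷ _ ∷ d≤c ∷ [] = ⊥-elim (<⇒≱ v1 d≤c)
3412-drop-min-last X y al (a , b , c , d , s , v1 , v2 , v3) | _ ∷ _ ∷ _ ∷ [] , _ ∷ [] , refl , s1 , skip ()
3412-drop-min-last X y al (a , b , c , d , s , v1 , v2 , v3) | _ , _ ∷ _ ∷ _ , e , s1 , skip ()
3412-drop-min-last X y al (a , b , c , d , s , v1 , v2 , v3) | _ , _ ∷ _ ∷ _ , e , s1 , keep ()
3412-drop-min-last X y al (a , b , c , d , s , v1 , v2 , v3) | _ ∷ _ ∷ _ ∷ _ ∷ _ ∷ _ , _ , () , s1 , s2
3412-drop-min-last X y al (a , b , c , d , s , v1 , v2 , v3) | _ ∷ _ ∷ _ ∷ _ ∷ [] , _ ∷ _ , () , s1 , s2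

3412-unshift : ∀ c X → Pat3412 (sh c X) → Pat3412 X
3412-unshift c X (a , b , e , d , s , v1 , v2 , v3) with ⊑-sh⁻ c X s
... | a' ∷ b' ∷ e' ∷ d' ∷ [] , refl , s' =
  a' , b' , e' , d' , s' , +-cancelˡ-< c _ _ v1 , +-cancelˡ-< c _ _ v2 , +-cancelˡ-< c _ _ v3

3412-shift : ∀ c X → Pat3412 X → Pat3412 (sh c X)
3412-shift c X (a , b , d , e , s , v1 , v2 , v3) =
  c + a , c + b , c + d , c + e , ⊑-sh⁺ c s , +-monoʳ-< c v1 , +-monoʳ-< c v2 , +-monoʳ-< c v3

inner-entries : ∀ a → All (λ x → 1 ≤ x × x ≤ suc (size a)) (sh 1 (inv a))
inner-entries a = All.map⁺ (All.map (λ q → s≤s z≤n , s≤s (proj₂ q)) (inv-range-All a))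

-- inv t avoids 3412: an occurrence would lie in a single block.
inv-avoids-3412 : ∀ t → ¬ Pat3412 (inv t)
inv-avoids-3412 leaf (a , b , c , d , () , _)
inv-avoids-3412 (hstep t) p with 3412-split (1 ∷ []) (sh 1 (inv t)) 1 (≤-refl ∷ []) (sh-above 1 (All.map proj₁ (inv-range-All t))) p
... | inj₁ (a , b , c , d , skip () , _)
... | inj₁ (a , b , c , d , keep () , _)
... | inj₂ q = inv-avoids-3412 t (3412-unshift 1 (inv t) q)
inv-avoids-3412 (arch a b) p with 3412-split (inner-part a) (sh k (inv b)) k below above-k (subst Pat3412 (inv-arch-split a b) p)
  where
  k = suc (suc (size a))
  below : All (_≤ k) (inner-part a)
  below = ≤-refl ∷ All.++⁺ (All.map (λ q → m≤n⇒m≤1+n (proj₂ q)) (inner-entries a)) (s≤s z≤n ∷ [])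
  above-k : All (k <_) (sh k (inv b))
  above-k = sh-above k (All.map proj₁ (inv-range-All b))
... | inj₁ q = inv-avoids-3412 a (3412-unshift 1 (inv a)
  (3412-drop-min-last (sh 1 (inv a)) 1 (All.map proj₁ (inner-entries a))
    (3412-drop-max-head (suc (suc (size a))) _ (All.++⁺ (All.map (λ q → m≤n⇒m≤1+n (proj₂ q)) (inner-entries a)) (s≤s z≤n ∷ [])) q)))
... | inj₂ q = inv-avoids-3412 b (3412-unshift (suc (suc (size a))) (inv b) q)

-- The step of Ψ at a point only depends on the point and its image.
ΨStep-shift : ∀ w v c i → val w (c + i) ≡ c + val v i → ΨStep w (c + i) ≡ ΨStep v i
ΨStep-shift w v c i e rewrite e | ≡ᵇ-+ c (val v i) i | <ᵇ-+ c i (val v i) = refl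

map-sh-cong : ∀ {X : Set} (g h : ℕ → X) c n → (∀ x → 1 ≤ x → x ≤ n → g (c + x) ≡ h x) →
  map g (sh c [1‥ n ]) ≡ map h [1‥ n ]
map-sh-cong g h c n e = trans (sym (map-∘ [1‥ n ]))
  (map-cong-local (tabulate λ {x} x∈ → let (p , q) = ∈[1‥]⇒range n x∈ in e x p q))

steps-in-block : ∀ w c v m → Agrees w c v m → map (ΨStep w) (sh c [1‥ m ]) ≡ map (ΨStep v) [1‥ m ]
steps-in-block w c v m ag = map-sh-cong (ΨStep w) (ΨStep v) c m (λ x p q → ΨStep-shift w v c x (ag x p q))

inv-steps : ∀ t → map (ΨStep (inv t)) [1‥ size t ] ≡ flat t
inv-steps leaf = refl
inv-steps (hstep t) = begin
    map (ΨStep w) [1‥ suc (size t) ]   ≡⟨ cong (map (ΨStep w)) ([1‥suc] (size t)) ⟩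
    H ∷ map (ΨStep w) (sh 1 [1‥ size t ]) ≡⟨ cong (H ∷_) (steps-in-block w 1 (inv t) (size t) (agrees-hstep t)) ⟩
    H ∷ map (ΨStep (inv t)) [1‥ size t ] ≡⟨ cong (H ∷_) (inv-steps t) ⟩
    H ∷ flat t                          ∎
  where
  open ≡-Reasoning
  w = inv (hstep t)
inv-steps (arch a b) = begin
    map f [1‥ k + size b ]  ≡⟨ cong (map f) ([1‥arch] (size a) (size b)) ⟩
    U ∷ map f (sh 1 [1‥ size a ] ++ k ∷ sh k [1‥ size b ])
      ≡⟨ cong (U ∷_) (map-++ f (sh 1 [1‥ size a ]) (k ∷ sh k [1‥ size b ])) ⟩
    U ∷ map f (sh 1 [1‥ size a ]) ++ f k ∷ map f (sh k [1‥ size b ])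
      ≡⟨ cong (U ∷_) (cong₂ _++_ (steps-in-block w 1 (inv a) (size a) (agrees-inner a b))
                                 (cong₂ _∷_ fk≡D (steps-in-block w k (inv b) (size b) (agrees-outer a b)))) ⟩
    U ∷ map (ΨStep (inv a)) [1‥ size a ] ++ D ∷ map (ΨStep (inv b)) [1‥ size b ]
      ≡⟨ cong₂ (λ x y → U ∷ x ++ D ∷ y) (inv-steps a) (inv-steps b) ⟩
    flat (arch a b)         ∎
  where
  open ≡-Reasoning
  k = suc (suc (size a))
  w = inv (arch a b)
  f = ΨStep w
  fk≡D : f k ≡ D
  fk≡D rewrite val-close a b = refl

countB-none : ∀ {X : Set} (p : X → Bool) L → (∀ x → x ∈ L → p x ≡ false) → countB p L ≡ 0
countB-none p [] h = refl
countB-none p (x ∷ L) h rewrite h x (here refl) = countB-none p L (λ y m → h y (there m))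

map-zero : ∀ {X : Set} (f : X → ℕ) L → (∀ x → f x ≡ 0) → map f L ≡ replicate (length L) 0
map-zero f [] h = refl
map-zero f (x ∷ L) h = cong₂ _∷_ (h x) (map-zero f L h)

-- The label of Ψ at the larger point of a 2-cycle counts crossing arcs.
ΨLabel-zero : ∀ w → NonCrossing w → ∀ i → ΨLabel w i ≡ 0
ΨLabel-zero w nc i with val w i <ᵇ i
... | false = refl
... | true = countB-none _ [1‥ length w ] (λ x _ → no-crossing x)
  where
  no-crossing : ∀ x → ((val w i <ᵇ x) ∧ (x <ᵇ i) ∧ (i <ᵇ val w x)) ≡ false
  no-crossing x with val w i <ᵇ x in e1
  ... | false = refl
  ... | true with x <ᵇ i in e2
  ... | false = refl
  ... | true = ≮⇒<ᵇ-false (nc i x (<ᵇ-true⇒< e1) (<ᵇ-true⇒< e2))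

Ψ-inv : ∀ t → Ψ (inv t) ≡ motz t
Ψ-inv t = cong₂ _,_
  (trans (cong (λ n → map (ΨStep (inv t)) [1‥ n ]) (length-inv t)) (inv-steps t))
  (trans (map-zero (ΨLabel (inv t)) [1‥ length (inv t) ] (ΨLabel-zero (inv t) (inv-noncrossing t)))
         (cong (λ m → replicate m 0) (trans (length-[1‥] (length (inv t))) (length-inv t))))

-- The permutation coded by a tree: the standard cycle form of inv t.  For
-- hstep t the cycle (1) comes last; for arch a b the cycles of b (least
-- elements above k) come first, then those of a, then the cycle (1 k).

cyc : MTree → List ℕ
cyc leaf = []
cyc (hstep t) = sh 1 (cyc t) ++ 1 ∷ []
cyc (arch a b) = sh (suc (suc (size a))) (cyc b) ++ sh 1 (cyc a) ++ 1 ∷ suc (suc (size a)) ∷ []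

cyclesUpTo : List ℕ → ℕ → List ℕ
cyclesUpTo w n = concatMap (cycleAt w) (map suc (downFrom n))

cyclesIn : List ℕ → ℕ → ℕ → List ℕ
cyclesIn w c m = concatMap (λ i → cycleAt w (c + i)) (map suc (downFrom m))

cyclesUpTo-+ : ∀ w c m → cyclesUpTo w (c + m) ≡ cyclesIn w c m ++ cyclesUpTo w c
cyclesUpTo-+ w c zero = cong (cyclesUpTo w) (+-identityʳ c)
cyclesUpTo-+ w c (suc m) = begin
    cyclesUpTo w (c + suc m)                               ≡⟨ cong (cyclesUpTo w) (+-suc c m) ⟩
    cycleAt w (suc (c + m)) ++ cyclesUpTo w (c + m)        ≡⟨ cong₂ (λ z L → cycleAt w z ++ L) (sym (+-suc c m)) (cyclesUpTo-+ w c m) ⟩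
    cycleAt w (c + suc m) ++ cyclesIn w c m ++ cyclesUpTo w c ≡⟨ sym (++-assoc (cycleAt w (c + suc m)) _ _) ⟩
    cyclesIn w c (suc m) ++ cyclesUpTo w c                 ∎
  where open ≡-Reasoning

cycleAt-shift : ∀ w v c i → val w (c + i) ≡ c + val v i → cycleAt w (c + i) ≡ sh c (cycleAt v i)
cycleAt-shift w v c i e rewrite e | ≡ᵇ-+ c (val v i) i | <ᵇ-+ c i (val v i) with val v i ≡ᵇ i
... | true = refl
... | false with i <ᵇ val v i
... | true = refl
... | false = refl

cycles-in-block : ∀ w c v m → Agrees w c v m → cyclesIn w c m ≡ sh c (cyclesUpTo v m)
cycles-in-block w c v zero ag = refl
cycles-in-block w c v (suc m) ag = begin
    cycleAt w (c + suc m) ++ cyclesIn w c m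
      ≡⟨ cong₂ _++_ (cycleAt-shift w v c (suc m) (ag (suc m) (s≤s z≤n) ≤-refl))
                    (cycles-in-block w c v m (λ i p q → ag i p (m≤n⇒m≤1+n q))) ⟩
    sh c (cycleAt v (suc m)) ++ sh c (cyclesUpTo v m) ≡⟨ sym (map-++ (c +_) (cycleAt v (suc m)) _) ⟩
    sh c (cyclesUpTo v (suc m))                        ∎
  where open ≡-Reasoning

cyclesUpTo-inv : ∀ t → cyclesUpTo (inv t) (size t) ≡ cyc t
cyclesUpTo-inv leaf = refl
cyclesUpTo-inv (hstep t) = begin
    cyclesUpTo w (1 + size t)                   ≡⟨ cyclesUpTo-+ w 1 (size t) ⟩
    cyclesIn w 1 (size t) ++ 1 ∷ []             ≡⟨ cong (_++ 1 ∷ []) (cycles-in-block w 1 (inv t) (size t) (agrees-hstep t)) ⟩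
    sh 1 (cyclesUpTo (inv t) (size t)) ++ 1 ∷ [] ≡⟨ cong (λ L → sh 1 L ++ 1 ∷ []) (cyclesUpTo-inv t) ⟩
    cyc (hstep t)                               ∎
  where
  open ≡-Reasoning
  w = inv (hstep t)
cyclesUpTo-inv (arch a b) = begin
    cyclesUpTo w (k + size b)                         ≡⟨ cyclesUpTo-+ w k (size b) ⟩
    cyclesIn w k (size b) ++ cyclesUpTo w k           ≡⟨ cong₂ _++_ (cycles-in-block w k (inv b) (size b) (agrees-outer a b)) no-cycle-at-k ⟩
    sh k (cyclesUpTo (inv b) (size b)) ++ cyclesUpTo w (1 + size a) ≡⟨ cong (sh k (cyclesUpTo (inv b) (size b)) ++_) (cyclesUpTo-+ w 1 (size a)) ⟩
    sh k (cyclesUpTo (inv b) (size b)) ++ cyclesIn w 1 (size a) ++ 1 ∷ k ∷ []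
      ≡⟨ cong (λ L → sh k (cyclesUpTo (inv b) (size b)) ++ L ++ 1 ∷ k ∷ []) (cycles-in-block w 1 (inv a) (size a) (agrees-inner a b)) ⟩
    sh k (cyclesUpTo (inv b) (size b)) ++ sh 1 (cyclesUpTo (inv a) (size a)) ++ 1 ∷ k ∷ []
      ≡⟨ cong₂ (λ B A → sh k B ++ sh 1 A ++ 1 ∷ k ∷ []) (cyclesUpTo-inv b) (cyclesUpTo-inv a) ⟩
    cyc (arch a b)                                    ∎
  where
  open ≡-Reasoning
  k = suc (suc (size a))
  w = inv (arch a b)
  -- k is the larger point of the cycle (1 k), so it starts no cycle.
  no-cycle-at-k : cyclesUpTo w k ≡ cyclesUpTo w (1 + size a)
  no-cycle-at-k rewrite val-close a b = refl

F-inv : ∀ t → F (inv t) ≡ cyc t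
F-inv t = trans (cong (cyclesUpTo (inv t)) (length-inv t)) (cyclesUpTo-inv t)

cyc-perm : ∀ t → cyc t ↭ [1‥ size t ]
cyc-perm leaf = ↭-refl
cyc-perm (hstep t) = subst (cyc (hstep t) ↭_) (sym ([1‥suc] (size t)))
  (↭-trans (++-comm (sh 1 (cyc t)) (1 ∷ [])) (prep 1 (↭-map⁺ (1 +_) (cyc-perm t))))
cyc-perm (arch a b) = subst (cyc (arch a b) ↭_) (sym ([1‥arch] (size a) (size b)))
  (↭-trans (↭-++⁺ (↭-map⁺ (k +_) (cyc-perm b)) (↭-++⁺ (↭-map⁺ (1 +_) (cyc-perm a)) (↭-refl {x = 1 ∷ k ∷ []})))
  (↭-trans (++-comm Y (X ++ 1 ∷ k ∷ []))
  (subst (_↭ 1 ∷ X ++ k ∷ Y) (sym (++-assoc X (1 ∷ k ∷ []) Y)) (shift 1 X (k ∷ Y)))))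
  where
  k = suc (suc (size a))
  X = sh 1 [1‥ size a ]
  Y = sh k [1‥ size b ]

cyc-range : ∀ t {x} → x ∈ cyc t → 1 ≤ x × x ≤ size t
cyc-range t m = ∈[1‥]⇒range (size t) (∈-resp-↭ (cyc-perm t) m)

cyc-range-All : ∀ t → All (λ x → 1 ≤ x × x ≤ size t) (cyc t)
cyc-range-All t = tabulate (cyc-range t)

cyc-∈ : ∀ t {x} → 1 ≤ x → x ≤ size t → x ∈ cyc t
cyc-∈ t p q = ∈-resp-↭ (↭-sym (cyc-perm t)) (range⇒∈[1‥] (size t) p q)

length-cyc : ∀ t → length (cyc t) ≡ size t
length-cyc t = trans (↭-length (cyc-perm t)) (length-[1‥] (size t))

arch-tail-below : ∀ a → All (_≤ suc (suc (size a))) (sh 1 (cyc a) ++ 1 ∷ suc (suc (size a)) ∷ [])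
arch-tail-below a = All.++⁺ (sh-below 1 (All.map (λ q → m≤n⇒m≤1+n (proj₂ q)) (cyc-range-All a))) (s≤s z≤n ∷ ≤-refl ∷ [])

132-split : ∀ X R m → All (m <_) X → All (_≤ m) R → Pat132 (X ++ R) → Pat132 X ⊎ Pat132 R
132-split X R m aX aR (a , b , c , s , v1 , v2) with ⊑-split X R s
... | [] , _ , refl , s1 , s2 = inj₂ (a , b , c , s2 , v1 , v2)
... | _ ∷ [] , _ , refl , s1 , s2 with ⊑-All s1 aX | ⊑-All s2 aR
... | pa ∷ [] | _ ∷ pc ∷ [] = ⊥-elim (<⇒≱ (<-trans pa v1) pc)
132-split X R m aX aR (a , b , c , s , v1 , v2) | _ ∷ _ ∷ [] , _ , refl , s1 , s2 with ⊑-All s1 aX | ⊑-All s2 aR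
... | pa ∷ _ | pc ∷ [] = ⊥-elim (<⇒≱ (<-trans pa v1) pc)
132-split X R m aX aR (a , b , c , s , v1 , v2) | _ ∷ _ ∷ _ ∷ [] , _ , refl , s1 , s2 =
  inj₁ (a , b , c , subst (_⊑ X) (sym (++-identityʳ _)) s1 , v1 , v2)
132-split X R m aX aR (a , b , c , s , v1 , v2) | _ ∷ _ ∷ _ ∷ _ ∷ _ , _ , () , s1 , s2

132-unshift : ∀ c X → Pat132 (sh c X) → Pat132 X
132-unshift c X (a , b , e , s , v1 , v2) with ⊑-sh⁻ c X s
... | a' ∷ b' ∷ e' ∷ [] , refl , s' = a' , b' , e' , s' , +-cancelˡ-< c _ _ v1 , +-cancelˡ-< c _ _ v2

132-shift : ∀ c X → Pat132 X → Pat132 (sh c X)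
132-shift c X (a , b , d , s , v1 , v2) = c + a , c + b , c + d , ⊑-sh⁺ c s , +-monoʳ-< c v1 , +-monoʳ-< c v2

132-drop-1k : ∀ Y k → All (λ y → 1 ≤ y × y < k) Y → Pat132 (Y ++ 1 ∷ k ∷ []) → Pat132 Y
132-drop-1k Y k aY (a , b , c , s , v1 , v2) with ⊑-split Y (1 ∷ k ∷ []) s
... | _ ∷ _ ∷ _ ∷ [] , [] , refl , s1 , s2 = a , b , c , subst (_⊑ Y) (sym (++-identityʳ _)) s1 , v1 , v2
... | _ ∷ _ ∷ [] , _ ∷ [] , refl , s1 , keep _ with ⊑-All s1 aY
... | (pa , _) ∷ _ = ⊥-elim (<⇒≱ v1 pa)
132-drop-1k Y k aY (a , b , c , s , v1 , v2) | _ ∷ _ ∷ [] , _ ∷ [] , refl , s1 , skip (keep _) with ⊑-All s1 aY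
... | _ ∷ (_ , pb) ∷ [] = ⊥-elim (<-asym v2 pb)
132-drop-1k Y k aY (a , b , c , s , v1 , v2) | _ ∷ [] , _ ∷ _ ∷ [] , refl , s1 , keep (keep _) with ⊑-All s1 aY
... | (pa , _) ∷ [] = ⊥-elim (<⇒≱ (<-trans v1 v2) pa)
132-drop-1k Y k aY (a , b , c , s , v1 , v2) | _ ∷ _ ∷ [] , _ ∷ [] , refl , s1 , skip (skip ())
132-drop-1k Y k aY (a , b , c , s , v1 , v2) | _ ∷ [] , _ ∷ _ ∷ [] , refl , s1 , keep (skip ())
132-drop-1k Y k aY (a , b , c , s , v1 , v2) | _ ∷ [] , _ ∷ _ ∷ [] , refl , s1 , skip (keep ())
132-drop-1k Y k aY (a , b , c , s , v1 , v2) | _ ∷ [] , _ ∷ _ ∷ [] , refl , s1 , skip (skip ())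
132-drop-1k Y k aY (a , b , c , s , v1 , v2) | [] , _ ∷ _ ∷ _ ∷ [] , refl , s1 , keep (keep ())
132-drop-1k Y k aY (a , b , c , s , v1 , v2) | [] , _ ∷ _ ∷ _ ∷ [] , refl , s1 , keep (skip ())
132-drop-1k Y k aY (a , b , c , s , v1 , v2) | [] , _ ∷ _ ∷ _ ∷ [] , refl , s1 , skip (keep ())
132-drop-1k Y k aY (a , b , c , s , v1 , v2) | [] , _ ∷ _ ∷ _ ∷ [] , refl , s1 , skip (skip ())
132-drop-1k Y k aY (a , b , c , s , v1 , v2) | _ ∷ _ ∷ _ ∷ _ ∷ _ , _ , () , s1 , s2
132-drop-1k Y k aY (a , b , c , s , v1 , v2) | _ ∷ _ ∷ _ ∷ [] , _ ∷ _ , () , s1 , s2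

-- cyc t avoids 132: an occurrence would lie in a single block.
cyc-avoids-132 : ∀ t → ¬ Pat132 (cyc t)
cyc-avoids-132 leaf (a , b , c , () , _)
cyc-avoids-132 (hstep t) p with 132-split (sh 1 (cyc t)) (1 ∷ []) 1 (sh-above 1 (All.map proj₁ (cyc-range-All t))) (≤-refl ∷ []) p
... | inj₁ q = cyc-avoids-132 t (132-unshift 1 (cyc t) q)
... | inj₂ (a , b , c , skip () , _)
... | inj₂ (a , b , c , keep () , _)
cyc-avoids-132 (arch a b) p
  with 132-split (sh k (cyc b)) _ k (sh-above k (All.map proj₁ (cyc-range-All b))) (arch-tail-below a) p
  where k = suc (suc (size a))
... | inj₁ q = cyc-avoids-132 b (132-unshift (suc (suc (size a))) (cyc b) q)
... | inj₂ q = cyc-avoids-132 a (132-unshift 1 (cyc a) (132-drop-1k (sh 1 (cyc a)) (suc (suc (size a)))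
       (All.map⁺ (All.map (λ q → s≤s z≤n , s≤s (s≤s (proj₂ q))) (cyc-range-All a))) q))

C123-split : ∀ A B m → All (m <_) A → All (_≤ m) B → C123 (A ++ B) → C123 A ⊎ C123 B
C123-split [] B m aA aB c = inj₂ c
C123-split (a ∷ []) (b1 ∷ b2 ∷ r) m (pa ∷ []) (pb ∷ _) (inj₁ (p , _)) = ⊥-elim (<⇒≱ (<-trans pa p) pb)
C123-split (a ∷ []) (b1 ∷ b2 ∷ r) m aA aB (inj₂ c) = inj₂ c
C123-split (a ∷ a' ∷ []) (b ∷ r) m (_ ∷ pa' ∷ []) (pb ∷ _) (inj₁ (_ , p)) = ⊥-elim (<⇒≱ (<-trans pa' p) pb)
C123-split (a ∷ a' ∷ []) (b ∷ r) m (_ ∷ aA) aB (inj₂ c) = C123-split (a' ∷ []) (b ∷ r) m aA aB c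
C123-split (a ∷ a' ∷ a'' ∷ A) B m aA aB (inj₁ p) = inj₁ (inj₁ p)
C123-split (a ∷ a' ∷ a'' ∷ A) B m (_ ∷ aA) aB (inj₂ c) with C123-split (a' ∷ a'' ∷ A) B m aA aB c
... | inj₁ c' = inj₁ (inj₂ c')
... | inj₂ c' = inj₂ c'

C123-drop-pair : ∀ Y x y → All (x ≤_) Y → C123 (Y ++ x ∷ y ∷ []) → C123 Y
C123-drop-pair (y1 ∷ []) x y (p ∷ []) (inj₁ (q , _)) = ⊥-elim (<⇒≱ q p)
C123-drop-pair (y1 ∷ y2 ∷ []) x y (_ ∷ p ∷ []) (inj₁ (_ , q)) = ⊥-elim (<⇒≱ q p)
C123-drop-pair (y1 ∷ y2 ∷ []) x y (_ ∷ aY) (inj₂ c) = ⊥-elim (C123-drop-pair (y2 ∷ []) x y aY c)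
C123-drop-pair (y1 ∷ y2 ∷ y3 ∷ Y) x y aY (inj₁ p) = inj₁ p
C123-drop-pair (y1 ∷ y2 ∷ y3 ∷ Y) x y (_ ∷ aY) (inj₂ c) = inj₂ (C123-drop-pair (y2 ∷ y3 ∷ Y) x y aY c)

C123-unshift : ∀ c X → C123 (sh c X) → C123 X
C123-unshift c (x ∷ y ∷ z ∷ r) (inj₁ (p , q)) = inj₁ (+-cancelˡ-< c _ _ p , +-cancelˡ-< c _ _ q)
C123-unshift c (x ∷ y ∷ z ∷ r) (inj₂ q) = inj₂ (C123-unshift c (y ∷ z ∷ r) q)

C123-shift : ∀ c X → C123 X → C123 (sh c X)
C123-shift c (x ∷ y ∷ z ∷ r) (inj₁ (p , q)) = inj₁ (+-monoʳ-< c p , +-monoʳ-< c q)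
C123-shift c (x ∷ y ∷ z ∷ r) (inj₂ q) = inj₂ (C123-shift c (y ∷ z ∷ r) q)

cyc-avoids-C123 : ∀ t → ¬ C123 (cyc t)
cyc-avoids-C123 leaf ()
cyc-avoids-C123 (hstep t) p with C123-split (sh 1 (cyc t)) (1 ∷ []) 1 (sh-above 1 (All.map proj₁ (cyc-range-All t))) (≤-refl ∷ []) p
... | inj₁ q = cyc-avoids-C123 t (C123-unshift 1 (cyc t) q)
cyc-avoids-C123 (arch a b) p
  with C123-split (sh k (cyc b)) _ k (sh-above k (All.map proj₁ (cyc-range-All b))) (arch-tail-below a) p
  where k = suc (suc (size a))
... | inj₁ q = cyc-avoids-C123 b (C123-unshift (suc (suc (size a))) (cyc b) q)
... | inj₂ q = cyc-avoids-C123 a (C123-unshift 1 (cyc a)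
       (C123-drop-pair (sh 1 (cyc a)) 1 (suc (suc (size a))) (All.map⁺ (All.map (λ _ → s≤s z≤n) (cyc-range-All a))) q))

-- Ascending runs.  consRun′ repeats the (private) step of Defs.runs.

consRun′ : ℕ → List (List ℕ) → List (List ℕ)
consRun′ x [] = (x ∷ []) ∷ []
consRun′ x ([] ∷ rs) = (x ∷ []) ∷ rs
consRun′ x ((y ∷ r) ∷ rs) = if x <ᵇ y then (x ∷ y ∷ r) ∷ rs else (x ∷ []) ∷ (y ∷ r) ∷ rs

runs-cons : ∀ x xs → runs (x ∷ xs) ≡ consRun′ x (runs xs)
runs-cons x xs with runs xs
... | [] = refl
... | [] ∷ rs = refl
... | (y ∷ r) ∷ rs = refl

runs-nonempty : ∀ y ys → ∃[ r ] ∃[ rs ] (runs (y ∷ ys) ≡ (y ∷ r) ∷ rs)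
runs-nonempty y ys with runs ys
... | [] = [] , [] , refl
... | [] ∷ rs = [] , rs , refl
... | (z ∷ r) ∷ rs with y <ᵇ z
... | true = z ∷ r , rs , refl
... | false = [] , (z ∷ r) ∷ rs , refl

runs-sh : ∀ c xs → runs (sh c xs) ≡ map (sh c) (runs xs)
runs-sh c [] = refl
runs-sh c (x ∷ xs) = begin
    runs (c + x ∷ sh c xs)                 ≡⟨ runs-cons (c + x) (sh c xs) ⟩
    consRun′ (c + x) (runs (sh c xs))       ≡⟨ cong (consRun′ (c + x)) (runs-sh c xs) ⟩
    consRun′ (c + x) (map (sh c) (runs xs)) ≡⟨ consRun′-sh (runs xs) ⟩
    map (sh c) (consRun′ x (runs xs))       ≡⟨ cong (map (sh c)) (sym (runs-cons x xs)) ⟩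
    map (sh c) (runs (x ∷ xs))              ∎
  where
  open ≡-Reasoning
  consRun′-sh : ∀ R → consRun′ (c + x) (map (sh c) R) ≡ map (sh c) (consRun′ x R)
  consRun′-sh [] = refl
  consRun′-sh ([] ∷ rs) = refl
  consRun′-sh ((y ∷ r) ∷ rs) rewrite <ᵇ-+ c x y with x <ᵇ y
  ... | true = refl
  ... | false = refl

HeadAtMost : ℕ → List ℕ → Set
HeadAtMost m [] = ⊤
HeadAtMost m (y ∷ _) = y ≤ m

All⇒HeadAtMost : ∀ {m L} → All (_≤ m) L → HeadAtMost m L
All⇒HeadAtMost [] = tt
All⇒HeadAtMost (p ∷ _) = p

runs-++ : ∀ xs ys m → All (m <_) xs → HeadAtMost m ys → runs (xs ++ ys) ≡ runs xs ++ runs ys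
runs-++ [] ys m _ _ = refl
runs-++ (x ∷ []) [] m _ _ = refl
runs-++ (x ∷ []) (y ∷ ys) m (m<x ∷ []) y≤m with runs-nonempty y ys
... | r , rs , e = begin
    runs (x ∷ y ∷ ys)                   ≡⟨ runs-cons x (y ∷ ys) ⟩
    consRun′ x (runs (y ∷ ys))           ≡⟨ cong (consRun′ x) e ⟩
    consRun′ x ((y ∷ r) ∷ rs)            ≡⟨ cong (λ b → if b then (x ∷ y ∷ r) ∷ rs else (x ∷ []) ∷ (y ∷ r) ∷ rs) x≮ᵇy ⟩
    (x ∷ []) ∷ (y ∷ r) ∷ rs              ≡⟨ cong ((x ∷ []) ∷_) (sym e) ⟩
    (x ∷ []) ∷ runs (y ∷ ys)             ∎
  where
  open ≡-Reasoning
  x≮ᵇy = ≮⇒<ᵇ-false (λ x<y → <⇒≱ x<y (≤-trans y≤m (<⇒≤ m<x)))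
runs-++ (x ∷ x' ∷ xs) ys m (_ ∷ al) y≤m with runs-nonempty x' xs
... | r , rs , e = begin
    runs (x ∷ x' ∷ xs ++ ys)                    ≡⟨ runs-cons x (x' ∷ xs ++ ys) ⟩
    consRun′ x (runs (x' ∷ xs ++ ys))            ≡⟨ cong (consRun′ x) (runs-++ (x' ∷ xs) ys m al y≤m) ⟩
    consRun′ x (runs (x' ∷ xs) ++ runs ys)       ≡⟨ cong (λ z → consRun′ x (z ++ runs ys)) e ⟩
    consRun′ x ((x' ∷ r) ∷ rs ++ runs ys)        ≡⟨ consRun′-++ ⟩
    consRun′ x ((x' ∷ r) ∷ rs) ++ runs ys        ≡⟨ cong (λ z → consRun′ x z ++ runs ys) (sym e) ⟩
    consRun′ x (runs (x' ∷ xs)) ++ runs ys       ≡⟨ cong (_++ runs ys) (sym (runs-cons x (x' ∷ xs))) ⟩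
    runs (x ∷ x' ∷ xs) ++ runs ys                ∎
  where
  open ≡-Reasoning
  consRun′-++ : consRun′ x ((x' ∷ r) ∷ rs ++ runs ys) ≡ consRun′ x ((x' ∷ r) ∷ rs) ++ runs ys
  consRun′-++ with x <ᵇ x'
  ... | true = refl
  ... | false = refl

-- The runs of cyc t have length one or two: the fixed points, and the
-- 2-cycles (1 k) of arches, shifted into place.

data Run : Set where
  single : ℕ → Run
  pair   : ℕ → ℕ → Run

elems : Run → List ℕ
elems (single x) = x ∷ []
elems (pair x y) = x ∷ y ∷ []

shRun : ℕ → Run → Run
shRun c (single x) = single (c + x)
shRun c (pair x y) = pair (c + x) (c + y)

elems-shRun : ∀ c r → elems (shRun c r) ≡ sh c (elems r)
elems-shRun c (single x) = refl
elems-shRun c (pair x y) = refl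

runsOf : MTree → List Run
runsOf leaf = []
runsOf (hstep t) = map (shRun 1) (runsOf t) ++ single 1 ∷ []
runsOf (arch a b) = map (shRun (suc (suc (size a)))) (runsOf b) ++ map (shRun 1) (runsOf a) ++ pair 1 (suc (suc (size a))) ∷ []

map-elems-shRun : ∀ c rs → map elems (map (shRun c) rs) ≡ map (sh c) (map elems rs)
map-elems-shRun c rs = trans (sym (map-∘ rs)) (trans (map-cong (elems-shRun c) rs) (map-∘ rs))

-- The blocks of cyc t are separated by descents, so its runs are runsOf t.
runs-cyc : ∀ t → runs (cyc t) ≡ map elems (runsOf t)
runs-cyc leaf = refl
runs-cyc (hstep t) = begin
    runs (sh 1 (cyc t) ++ 1 ∷ [])         ≡⟨ runs-++ (sh 1 (cyc t)) (1 ∷ []) 1 (sh-above 1 (All.map proj₁ (cyc-range-All t))) ≤-refl ⟩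
    runs (sh 1 (cyc t)) ++ (1 ∷ []) ∷ []   ≡⟨ cong (_++ (1 ∷ []) ∷ []) (trans (runs-sh 1 (cyc t)) (cong (map (sh 1)) (runs-cyc t))) ⟩
    map (sh 1) (map elems (runsOf t)) ++ (1 ∷ []) ∷ [] ≡⟨ sym (cong (_++ (1 ∷ []) ∷ []) (map-elems-shRun 1 (runsOf t))) ⟩
    map elems (map (shRun 1) (runsOf t)) ++ (1 ∷ []) ∷ [] ≡⟨ sym (map-++ elems (map (shRun 1) (runsOf t)) _) ⟩
    map elems (runsOf (hstep t))          ∎
  where open ≡-Reasoning
runs-cyc (arch a b) = begin
    runs (sh k (cyc b) ++ R)                  ≡⟨ runs-++ (sh k (cyc b)) R k (sh-above k (All.map proj₁ (cyc-range-All b))) (All⇒HeadAtMost (arch-tail-below a)) ⟩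
    runs (sh k (cyc b)) ++ runs R             ≡⟨ cong₂ _++_ (runs-block k b) (trans (runs-++ (sh 1 (cyc a)) (1 ∷ k ∷ []) 1 (sh-above 1 (All.map proj₁ (cyc-range-All a))) ≤-refl)
                                                                         (cong (_++ (1 ∷ k ∷ []) ∷ []) (runs-block 1 a))) ⟩
    map elems (map (shRun k) (runsOf b)) ++ map elems (map (shRun 1) (runsOf a)) ++ (1 ∷ k ∷ []) ∷ []
                                              ≡⟨ cong (map elems (map (shRun k) (runsOf b)) ++_) (sym (map-++ elems (map (shRun 1) (runsOf a)) _)) ⟩
    map elems (map (shRun k) (runsOf b)) ++ map elems (map (shRun 1) (runsOf a) ++ pair 1 k ∷ [])
                                              ≡⟨ sym (map-++ elems (map (shRun k) (runsOf b)) _) ⟩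
    map elems (runsOf (arch a b))             ∎
  where
  open ≡-Reasoning
  k = suc (suc (size a))
  R = sh 1 (cyc a) ++ 1 ∷ k ∷ []
  runs-block : ∀ c s → runs (sh c (cyc s)) ≡ map elems (map (shRun c) (runsOf s))
  runs-block c s = trans (runs-sh c (cyc s)) (trans (cong (map (sh c)) (runs-cyc s)) (sym (map-elems-shRun c (runsOf s))))

roles : Run → List (ℕ × Step)
roles r = runRoles (elems r)

rolesOf : MTree → List (ℕ × Step)
rolesOf t = concatMap roles (runsOf t)

shp : ℕ → ℕ × Step → ℕ × Step
shp c (x , s) = c + x , s

keys : List (ℕ × Step) → List ℕ
keys = map proj₁

rolesOf-shifted : ∀ c rs → concatMap roles (map (shRun c) rs) ≡ map (shp c) (concatMap roles rs)
rolesOf-shifted c [] = refl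
rolesOf-shifted c (r ∷ rs) = trans (cong₂ _++_ (roles-shRun r) (rolesOf-shifted c rs)) (sym (map-++ (shp c) (roles r) _))
  where
  roles-shRun : ∀ r → roles (shRun c r) ≡ map (shp c) (roles r)
  roles-shRun (single x) = refl
  roles-shRun (pair x y) = refl

rolesOf-hstep : ∀ t → rolesOf (hstep t) ≡ map (shp 1) (rolesOf t) ++ (1 , H) ∷ []
rolesOf-hstep t = trans (concatMap-++ roles (map (shRun 1) (runsOf t)) _) (cong (_++ (1 , H) ∷ []) (rolesOf-shifted 1 (runsOf t)))

rolesOf-arch : ∀ a b → rolesOf (arch a b) ≡
  map (shp (suc (suc (size a)))) (rolesOf b) ++ map (shp 1) (rolesOf a) ++ (1 , U) ∷ (suc (suc (size a)) , D) ∷ []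
rolesOf-arch a b = trans (concatMap-++ roles (map (shRun k) (runsOf b)) _)
  (cong₂ _++_ (rolesOf-shifted k (runsOf b))
    (trans (concatMap-++ roles (map (shRun 1) (runsOf a)) _) (cong (_++ (1 , U) ∷ (k , D) ∷ []) (rolesOf-shifted 1 (runsOf a)))))
  where k = suc (suc (size a))

keys-shp : ∀ c L → keys (map (shp c) L) ≡ sh c (keys L)
keys-shp c [] = refl
keys-shp c ((x , s) ∷ L) = cong (c + x ∷_) (keys-shp c L)

concat-runs : ∀ w → concat (runs w) ≡ w
concat-runs [] = refl
concat-runs (x ∷ xs) = trans (cong concat (runs-cons x xs)) (trans (concat-consRun′ (runs xs)) (cong (x ∷_) (concat-runs xs)))
  where
  concat-consRun′ : ∀ R → concat (consRun′ x R) ≡ x ∷ concat R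
  concat-consRun′ [] = refl
  concat-consRun′ ([] ∷ rs) = refl
  concat-consRun′ ((y ∷ r) ∷ rs) with x <ᵇ y
  ... | true = refl
  ... | false = refl

concat-runsOf : ∀ t → concat (map elems (runsOf t)) ≡ cyc t
concat-runsOf t = trans (cong concat (sym (runs-cyc t))) (concat-runs (cyc t))

keys-rolesOf : ∀ t → keys (rolesOf t) ≡ cyc t
keys-rolesOf t = begin
    keys (concat (map roles (runsOf t)))       ≡⟨ sym (concat-map (map roles (runsOf t))) ⟩
    concat (map keys (map roles (runsOf t)))   ≡⟨ cong concat (trans (sym (map-∘ (runsOf t))) (map-cong keys-roles (runsOf t))) ⟩
    concat (map elems (runsOf t))              ≡⟨ concat-runsOf t ⟩
    cyc t                                      ∎
  where
  open ≡-Reasoning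
  keys-roles : ∀ r → keys (roles r) ≡ elems r
  keys-roles (single x) = refl
  keys-roles (pair x y) = refl

lookup-skip : ∀ i P Q → i ∉ keys P → lookupRole i (P ++ Q) ≡ lookupRole i Q
lookup-skip i [] Q _ = refl
lookup-skip i ((x , s) ∷ P) Q i∉ rewrite ≢⇒≡ᵇ-false (λ e → i∉ (here (sym e))) = lookup-skip i P Q (λ m → i∉ (there m))

lookup-found : ∀ i P Q → i ∈ keys P → lookupRole i (P ++ Q) ≡ lookupRole i P
lookup-found i ((x , s) ∷ P) Q (here refl) rewrite ≡ᵇ-refl x = refl
lookup-found i ((x , s) ∷ P) Q (there m) with x ≡ᵇ i
... | true = refl
... | false = lookup-found i P Q m

lookup-shp : ∀ c i L → lookupRole (c + i) (map (shp c) L) ≡ lookupRole i L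
lookup-shp c i [] = refl
lookup-shp c i ((x , s) ∷ L) rewrite ≡ᵇ-+ c x i with x ≡ᵇ i
... | true = refl
... | false = lookup-shp c i L

∉-sh-cyc : ∀ c t {y} → y ≤ c ⊎ c + size t < y → y ∉ sh c (cyc t)
∉-sh-cyc c t (inj₁ y≤c) m = <⇒≱ (All.lookup (sh-above c (All.map proj₁ (cyc-range-All t))) m) y≤c
∉-sh-cyc c t (inj₂ c+n<y) m = <⇒≱ c+n<y (All.lookup (sh-below c (All.map proj₂ (cyc-range-All t))) m)

∉-keys-block : ∀ c t {y} → y ≤ c ⊎ c + size t < y → y ∉ keys (map (shp c) (rolesOf t))
∉-keys-block c t out = subst (_ ∉_) (sym (trans (keys-shp c (rolesOf t)) (cong (sh c) (keys-rolesOf t)))) (∉-sh-cyc c t out)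

lookup-block : ∀ P c t Q x → c + x ∉ keys P → 1 ≤ x → x ≤ size t →
  lookupRole (c + x) (P ++ map (shp c) (rolesOf t) ++ Q) ≡ lookupRole x (rolesOf t)
lookup-block P c t Q x c+x∉ p q = begin
    lookupRole (c + x) (P ++ map (shp c) (rolesOf t) ++ Q) ≡⟨ lookup-skip (c + x) P _ c+x∉ ⟩
    lookupRole (c + x) (map (shp c) (rolesOf t) ++ Q)      ≡⟨ lookup-found (c + x) (map (shp c) (rolesOf t)) Q c+x∈ ⟩
    lookupRole (c + x) (map (shp c) (rolesOf t))           ≡⟨ lookup-shp c x (rolesOf t) ⟩
    lookupRole x (rolesOf t)                               ∎
  where
  open ≡-Reasoning
  c+x∈ = subst (c + x ∈_) (sym (trans (keys-shp c (rolesOf t)) (cong (sh c) (keys-rolesOf t)))) (∈-map⁺ (c +_) (cyc-∈ t p q))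

cyc-steps : ∀ t → map (λ i → lookupRole i (rolesOf t)) [1‥ size t ] ≡ flat t
cyc-steps leaf = refl
cyc-steps (hstep t) rewrite rolesOf-hstep t = begin
    map g [1‥ suc (size t) ]         ≡⟨ cong (map g) ([1‥suc] (size t)) ⟩
    g 1 ∷ map g (sh 1 [1‥ size t ])  ≡⟨ cong₂ _∷_ (lookup-skip 1 (map (shp 1) (rolesOf t)) _ (∉-keys-block 1 t (inj₁ ≤-refl)))
                                                  (map-sh-cong g _ 1 (size t) (λ x → lookup-block [] 1 t _ x (λ ()))) ⟩
    H ∷ map (λ i → lookupRole i (rolesOf t)) [1‥ size t ] ≡⟨ cong (H ∷_) (cyc-steps t) ⟩
    flat (hstep t)                   ∎
  where
  open ≡-Reasoning
  g = λ i → lookupRole i (map (shp 1) (rolesOf t) ++ (1 , H) ∷ [])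
cyc-steps (arch a b) rewrite rolesOf-arch a b = begin
    map g [1‥ k + size b ]  ≡⟨ cong (map g) ([1‥arch] (size a) (size b)) ⟩
    g 1 ∷ map g (sh 1 [1‥ size a ] ++ k ∷ sh k [1‥ size b ]) ≡⟨ cong (g 1 ∷_) (map-++ g (sh 1 [1‥ size a ]) _) ⟩
    g 1 ∷ map g (sh 1 [1‥ size a ]) ++ g k ∷ map g (sh k [1‥ size b ])
      ≡⟨ cong₂ (λ x y → x ∷ y) g1≡U (cong₂ _++_ (map-sh-cong g _ 1 (size a) (λ x p q → lookup-block RB 1 a _ x (below-k q) p q))
                                               (cong₂ _∷_ gk≡D (map-sh-cong g _ k (size b) (λ x → lookup-block [] k b _ x (λ ()))))) ⟩
    U ∷ map (λ i → lookupRole i (rolesOf a)) [1‥ size a ] ++ D ∷ map (λ i → lookupRole i (rolesOf b)) [1‥ size b ]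
      ≡⟨ cong₂ (λ x y → U ∷ x ++ D ∷ y) (cyc-steps a) (cyc-steps b) ⟩
    flat (arch a b)         ∎
  where
  open ≡-Reasoning
  k = suc (suc (size a))
  RB = map (shp k) (rolesOf b)
  RA = map (shp 1) (rolesOf a)
  g = λ i → lookupRole i (RB ++ RA ++ (1 , U) ∷ (k , D) ∷ [])
  g1≡U : g 1 ≡ U
  g1≡U = trans (lookup-skip 1 RB _ (∉-keys-block k b (inj₁ (s≤s z≤n)))) (lookup-skip 1 RA _ (∉-keys-block 1 a (inj₁ ≤-refl)))
  gk≡D : g k ≡ D
  gk≡D = trans (lookup-skip k RB _ (∉-keys-block k b (inj₁ ≤-refl)))
        (trans (lookup-skip k RA _ (∉-keys-block 1 a (inj₂ ≤-refl)))
               (cong (λ b → if b then D else lookupRole k []) (≡ᵇ-refl k)))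
  below-k : ∀ {x} → x ≤ size a → 1 + x ∉ keys RB
  below-k q = ∉-keys-block k b (inj₁ (s≤s (m≤n⇒m≤1+n q)))

-- The labels of Γ on cyc t.  A run (x y) of cyc t comes from a 2-cycle, and
-- every value strictly between x and y appears before y; so no run is counted.

NestedRuns : MTree → Set
NestedRuns t = ∀ x y → pair x y ∈ runsOf t → ∀ i → x < i → i < y → pos (cyc t) i < pos (cyc t) y

pair-∈-shifted : ∀ c rs {x y} → pair x y ∈ map (shRun c) rs → ∃[ x' ] ∃[ y' ] (pair x' y' ∈ rs × x ≡ c + x' × y ≡ c + y')
pair-∈-shifted c rs m with ∈-map⁻ (shRun c) m
... | pair x' y' , m' , refl = x' , y' , m' , refl , refl

pair-∈-cyc : ∀ t {x y} → pair x y ∈ runsOf t → x ∈ cyc t × y ∈ cyc t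
pair-∈-cyc t m = in-cyc (here refl) , in-cyc (there (here refl))
  where
  in-cyc : ∀ {z} → z ∈ elems (pair _ _) → z ∈ cyc t
  in-cyc z∈ = subst (_ ∈_) (concat-runsOf t) (∈-concat⁺′ z∈ (∈-map⁺ elems m))

pos-middle : ∀ P c v R x → c + x ∉ P → x ∈ v → pos (P ++ sh c v ++ R) (c + x) ≡ length P + pos v x
pos-middle P c v R x c+x∉ x∈ = trans (pos-++ʳ P _ (c + x) c+x∉)
  (cong (length P +_) (trans (pos-++ˡ (sh c v) R (c + x) (∈-map⁺ (c +_) x∈)) (pos-sh c v x)))

nested-in-block : ∀ t P c R → NestedRuns t → (∀ z → z ∈ cyc t → c + z ∉ P) →
  ∀ x y → pair x y ∈ runsOf t → ∀ i → c + x < i → i < c + y →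
  pos (P ++ sh c (cyc t) ++ R) i < pos (P ++ sh c (cyc t) ++ R) (c + y)
nested-in-block t P c R nested disjoint x y m i c+x<i i<c+y with above c i (≤-<-trans (m≤m+n c x) c+x<i)
... | i' , refl , _ = subst₂ _<_ (sym (pos-middle P c (cyc t) R i' (disjoint i' i'∈) i'∈)) (sym (pos-middle P c (cyc t) R y (disjoint y y∈) y∈))
    (+-monoʳ-< (length P) (nested x y m i' x<i' i'<y))
  where
  x<i' = +-cancelˡ-< c x i' c+x<i
  i'<y = +-cancelˡ-< c i' y i<c+y
  y∈ = proj₂ (pair-∈-cyc t m)
  i'∈ = cyc-∈ t (≤-trans (proj₁ (cyc-range t (proj₁ (pair-∈-cyc t m)))) (<⇒≤ x<i'))
                (≤-trans (<⇒≤ i'<y) (proj₂ (cyc-range t y∈)))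

cyc-nested : ∀ t → NestedRuns t
cyc-nested (hstep t) x y m i x<i i<y with ∈-++⁻ (map (shRun 1) (runsOf t)) m
... | inj₁ m' with pair-∈-shifted 1 (runsOf t) m'
... | x' , y' , m'' , refl , refl = nested-in-block t [] 1 (1 ∷ []) (cyc-nested t) (λ _ _ ()) x' y' m'' i x<i i<y
cyc-nested (hstep t) x y m i x<i i<y | inj₂ (here ())
cyc-nested (hstep t) x y m i x<i i<y | inj₂ (there ())
cyc-nested (arch a b) x y m i x<i i<y with ∈-++⁻ (map (shRun (suc (suc (size a)))) (runsOf b)) m
... | inj₁ m' with pair-∈-shifted (suc (suc (size a))) (runsOf b) m'
... | x' , y' , m'' , refl , refl = nested-in-block b [] (suc (suc (size a))) _ (cyc-nested b) (λ _ _ ()) x' y' m'' i x<i i<y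
cyc-nested (arch a b) x y m i x<i i<y | inj₂ m₂ with ∈-++⁻ (map (shRun 1) (runsOf a)) m₂
... | inj₁ m' with pair-∈-shifted 1 (runsOf a) m'
... | x' , y' , m'' , refl , refl = nested-in-block a (sh (suc (suc (size a))) (cyc b)) 1 _ (cyc-nested a)
        (λ z z∈ → ∉-sh-cyc (suc (suc (size a))) b (inj₁ (s≤s (m≤n⇒m≤1+n (proj₂ (cyc-range a z∈)))))) x' y' m'' i x<i i<y
cyc-nested (arch a b) x y m i x<i i<y | inj₂ m₂ | inj₂ (there ())
-- The run (1 k) of the arch: the values between 1 and k form the inner block,
-- which precedes k.
cyc-nested (arch a b) .1 .(suc (suc (size a))) m (suc i') (s≤s 1≤i') (s≤s i'<k) | inj₂ m₂ | inj₂ (here refl) = begin-strict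
    pos W (1 + i')                                   ≡⟨ pos-middle P 1 (cyc a) R′ i' (∉-sh-cyc k b (inj₁ (s≤s (m≤n⇒m≤1+n i'≤n)))) i'∈ ⟩
    length P + pos (cyc a) i'                        <⟨ +-monoʳ-< (length P) (≤-<-trans (pos-≤ (cyc a) i' i'∈) (m<m+n (length (cyc a)) (s≤s z≤n))) ⟩
    length P + (length (cyc a) + 2)                  ≡⟨ cong₂ (λ n p → length P + (n + p)) (sym (length-sh 1 (cyc a))) (sym pos-k) ⟩
    length P + (length (sh 1 (cyc a)) + pos R′ k)    ≡⟨ sym (cong (length P +_) (pos-++ʳ (sh 1 (cyc a)) R′ k (∉-sh-cyc 1 a (inj₂ ≤-refl)))) ⟩
    length P + pos (sh 1 (cyc a) ++ R′) k            ≡⟨ sym (pos-++ʳ P _ k (∉-sh-cyc k b (inj₁ ≤-refl))) ⟩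
    pos W k                                          ∎
  where
  open ≤-Reasoning
  k = suc (suc (size a))
  P = sh k (cyc b)
  R′ = 1 ∷ k ∷ []
  W = cyc (arch a b)
  pos-k : pos R′ k ≡ 2
  pos-k rewrite ≡ᵇ-refl (size a) = refl
  i'≤n = ≤-pred i'<k
  i'∈ = cyc-∈ a 1≤i' i'≤n

ΓLabel-zero : ∀ t i → ΓLabel (cyc t) i ≡ 0
ΓLabel-zero t i = trans (cong (countB counted) (runs-cyc t)) (countB-none counted (map elems (runsOf t)) not-counted)
  where
  w = cyc t
  counted : List ℕ → Bool
  counted r = (runFirst r <ᵇ i) ∧ (i <ᵇ runLast r) ∧ (pos w (runLast r) <ᵇ pos w i)
  not-counted : ∀ r → r ∈ map elems (runsOf t) → counted r ≡ false
  not-counted _ m with ∈-map⁻ elems m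
  ... | single x , _ , refl with x <ᵇ i in e
  ...   | false = refl
  ...   | true = cong (λ b → b ∧ (pos w x <ᵇ pos w i)) (≮⇒<ᵇ-false (<-asym (<ᵇ-true⇒< {x} {i} e)))
  not-counted _ m | pair x y , m′ , refl with x <ᵇ i in e₁
  ...   | false = refl
  ...   | true with i <ᵇ y in e₂
  ...     | false = refl
  ...     | true = ≮⇒<ᵇ-false (<-asym (cyc-nested t x y m′ i (<ᵇ-true⇒< e₁) (<ᵇ-true⇒< {i} {y} e₂)))

ΓStep-cyc : ∀ t i → ΓStep (cyc t) i ≡ lookupRole i (rolesOf t)
ΓStep-cyc t i = trans (cong (λ R → lookupRole i (concatMap runRoles R)) (runs-cyc t))
                      (cong (λ R → lookupRole i (concat R)) (sym (map-∘ (runsOf t))))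

Γ-cyc : ∀ t → Γ (cyc t) ≡ motz t
Γ-cyc t = cong₂ _,_
  (trans (cong (λ n → map (ΓStep (cyc t)) [1‥ n ]) (length-cyc t))
         (trans (map-cong (ΓStep-cyc t) [1‥ size t ]) (cyc-steps t)))
  (trans (map-zero (ΓLabel (cyc t)) [1‥ length (cyc t) ] (ΓLabel-zero t))
         (cong (λ m → replicate m 0) (trans (length-[1‥] (length (cyc t))) (length-cyc t))))

record AvoidingInvolution (n : ℕ) (w : List ℕ) : Set where
  field
    length≡    : length w ≡ n
    range      : ∀ i → 1 ≤ i → i ≤ n → 1 ≤ val w i × val w i ≤ n
    involutive : ∀ i → 1 ≤ i → i ≤ n → val w (val w i) ≡ i
    avoids     : ¬ Pat3412 w

unsh : ℕ → List ℕ → List ℕ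
unsh c = map (_∸ c)

sh-unsh : ∀ c {L} → All (c ≤_) L → sh c (unsh c L) ≡ L
sh-unsh c [] = refl
sh-unsh c (c≤x ∷ al) = cong₂ _∷_ (m+[n∸m]≡n c≤x) (sh-unsh c al)

All-val : ∀ {P : ℕ → Set} L → (∀ i → 1 ≤ i → i ≤ length L → P (val L i)) → All P L
All-val [] h = []
All-val (x ∷ L) h = h 1 ≤-refl (s≤s z≤n) ∷ All-val L (λ { (suc i) p q → h (suc (suc i)) (s≤s z≤n) (s≤s q) })

val-middle : ∀ (X L Y : List ℕ) i → 1 ≤ i → i ≤ length L → val (X ++ L ++ Y) (length X + i) ≡ val L i
val-middle X L Y (suc i) _ le = trans (val-++ʳ X (L ++ Y) i) (val-++ˡ L Y i le)

length-middle : ∀ (X L Y : List ℕ) → length (X ++ L ++ Y) ≡ length X + length L + length Y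
length-middle X L Y = trans (length-++ X) (trans (cong (length X +_) (length-++ L)) (sym (+-assoc (length X) _ _)))

restrict : ∀ {n w} X L Y c → length X ≡ c → w ≡ X ++ L ++ Y → AvoidingInvolution n w →
  (∀ i → 1 ≤ i → i ≤ length L → c < val L i × val L i ≤ c + length L) →
  AvoidingInvolution (length L) (unsh c L) × sh c (unsh c L) ≡ L
restrict {n} {w} X L Y c refl refl I block = record
  { length≡ = length-map (_∸ c) L ; range = range′ ; involutive = involutive′ ; avoids = avoids′ } , shifted
  where
  open AvoidingInvolution I
  m = length L
  val-unsh : ∀ i → 1 ≤ i → i ≤ m → val (unsh c L) i ≡ val L i ∸ c
  val-unsh i p q = val-map (_∸ c) L i p q
  offset : ∀ i → 1 ≤ i → i ≤ m → ∃[ d ] (val L i ≡ c + d × 1 ≤ d × d ≤ m)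
  offset i p q with above c (val L i) (proj₁ (block i p q))
  ... | d , e , 1≤d = d , e , 1≤d , +-cancelˡ-≤ c d m (subst (_≤ c + m) e (proj₂ (block i p q)))
  range′ : ∀ i → 1 ≤ i → i ≤ m → 1 ≤ val (unsh c L) i × val (unsh c L) i ≤ m
  range′ i p q with offset i p q
  ... | d , e , 1≤d , d≤m rewrite val-unsh i p q | e | m+n∸m≡n c d = 1≤d , d≤m
  c+i≤n : ∀ i → i ≤ m → c + i ≤ n
  c+i≤n i q = ≤-trans (+-monoʳ-≤ c q) (subst (c + m ≤_) (trans (sym (length-middle X L Y)) length≡) (m≤m+n (c + m) (length Y)))
  involutive′ : ∀ i → 1 ≤ i → i ≤ m → val (unsh c L) (val (unsh c L) i) ≡ i
  involutive′ i p q with offset i p q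
  ... | d , e , 1≤d , d≤m = begin
      val (unsh c L) (val (unsh c L) i) ≡⟨ cong (val (unsh c L)) (trans (val-unsh i p q) (trans (cong (_∸ c) e) (m+n∸m≡n c d))) ⟩
      val (unsh c L) d                  ≡⟨ val-unsh d 1≤d d≤m ⟩
      val L d ∸ c                       ≡⟨ cong (_∸ c) (sym (val-middle X L Y d 1≤d d≤m)) ⟩
      val w (c + d) ∸ c                 ≡⟨ cong (λ z → val w z ∸ c) (sym (trans (val-middle X L Y i p q) e)) ⟩
      val w (val w (c + i)) ∸ c         ≡⟨ cong (_∸ c) (involutive (c + i) (≤-trans p (m≤n+m i c)) (c+i≤n i q)) ⟩
      c + i ∸ c                         ≡⟨ m+n∸m≡n c i ⟩
      i                                 ∎
    where open ≡-Reasoning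
  shifted : sh c (unsh c L) ≡ L
  shifted = sh-unsh c (All-val L (λ i p q → <⇒≤ (proj₁ (block i p q))))
  avoids′ : ¬ Pat3412 (unsh c L)
  avoids′ P with 3412-shift c _ P
  ... | a , b , d , e , s , v = avoids (a , b , d , e , ⊑-trans (subst (a ∷ b ∷ d ∷ e ∷ [] ⊑_) shifted s) (⊑-++ʳ X (⊑-++ˡ Y (⊑-refl L))) , v)

fixed-first : ∀ {n w'} → AvoidingInvolution (suc n) (1 ∷ w') →
  AvoidingInvolution n (unsh 1 w') × sh 1 (unsh 1 w') ≡ w'
fixed-first {n} {w'} I = subst (λ m → AvoidingInvolution m (unsh 1 w') × _) length-w'
  (restrict (1 ∷ []) w' [] 1 refl (cong (1 ∷_) (sym (++-identityʳ w'))) I block)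
  where
  open AvoidingInvolution I
  length-w' = suc-injective length≡
  block : ∀ i → 1 ≤ i → i ≤ length w' → 1 < val w' i × val w' i ≤ 1 + length w'
  block (suc i) p q = ≤∧≢⇒< (proj₁ (range (suc (suc i)) (s≤s z≤n) q′)) not-one
                    , subst (val w' (suc i) ≤_) (sym length≡) (proj₂ (range (suc (suc i)) (s≤s z≤n) q′))
    where
    q′ = subst (suc (suc i) ≤_) length≡ (s≤s q)
    -- 1 is the image of the fixed point 1 only
    not-one : 1 ≢ val w' (suc i)
    not-one e = 1+n≢0 (suc-injective (trans (sym (involutive (suc (suc i)) (s≤s z≤n) q′)) (cong (val (1 ∷ w')) (sym e))))

split-at : ∀ (xs : List ℕ) j → j < length xs → ∃[ A ] ∃[ y ] ∃[ B ] (xs ≡ A ++ y ∷ B × length A ≡ j)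
split-at (x ∷ xs) zero _ = [] , x , xs , refl , refl
split-at (x ∷ xs) (suc j) (s≤s p) with split-at xs j p
... | A , y , B , refl , refl = x ∷ A , y , B , refl , refl

-- An avoiding involution w = k ∷ w' with k = j+2 has w k = 1.  The positions
-- 2‥k-1 carry values in 2‥k-1, since a value v > k at such a position p would
-- give the occurrence k v 1 p of 3412; hence positions after k carry values
-- after k, and w is the arch of two smaller avoiding involutions.
module ArchCase {n j w'} (I : AvoidingInvolution n (suc (suc j) ∷ w')) where
  open AvoidingInvolution I

  k : ℕ
  k = suc (suc j)

  w : List ℕ
  w = k ∷ w'

  1≤n : 1 ≤ n
  1≤n = subst (1 ≤_) length≡ (s≤s z≤n)

  k≤n : k ≤ n
  k≤n = proj₂ (range 1 ≤-refl 1≤n)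

  val-k : val w k ≡ 1
  val-k = involutive 1 ≤-refl 1≤n

  inside-values : ∀ p → 1 ≤ p → p ≤ j → 1 < val w (suc p) × val w (suc p) < k
  inside-values p 1≤p p≤j = ≤∧≢⇒< v≥1 v≢1 , ≤∧≢⇒< (≮⇒≥ v≯k) v≢k
    where
    p+1≤n = ≤-trans (s≤s (m≤n⇒m≤1+n p≤j)) k≤n
    v = val w (suc p)
    v≥1 = proj₁ (range (suc p) (s≤s z≤n) p+1≤n)
    v≤n = proj₂ (range (suc p) (s≤s z≤n) p+1≤n)
    wv≡p+1 : val w v ≡ suc p
    wv≡p+1 = involutive (suc p) (s≤s z≤n) p+1≤n
    v≢1 : 1 ≢ v
    v≢1 e = <⇒≱ (s≤s (s≤s p≤j)) (≤-reflexive (trans (cong (val w) e) wv≡p+1))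
    v≢k : v ≢ k
    v≢k e = <⇒≱ 1≤p (≤-reflexive (sym (suc-injective (trans (sym val-k) (trans (cong (val w) (sym e)) wv≡p+1)))))
    v≯k : ¬ k < v
    v≯k k<v = avoids (Contains3412⇒Pat w (1 , suc p , k , v , ≤-refl , s≤s 1≤p , s≤s (s≤s p≤j) , k<v ,
      subst (v ≤_) (sym length≡) v≤n , subst₂ _<_ (sym val-k) (sym wv≡p+1) (s≤s 1≤p) , subst (_< k) (sym wv≡p+1) (s≤s (s≤s p≤j)) , k<v))

  outside-values : ∀ p → 1 ≤ p → k + p ≤ n → k < val w (k + p)
  outside-values p 1≤p k+p≤n = ≤∧≢⇒< (≮⇒≥ v≮k) (λ e → v≢k (sym e))
    where
    v = val w (k + p)
    v≥1 = proj₁ (range (k + p) (s≤s z≤n) k+p≤n)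
    wv≡k+p : val w v ≡ k + p
    wv≡k+p = involutive (k + p) (s≤s z≤n) k+p≤n
    v≢k : v ≢ k
    v≢k e = <⇒≱ (s≤s (s≤s z≤n)) (≤-reflexive (sym (trans (sym val-k) (trans (cong (val w) (sym e)) wv≡k+p))))
    v≮k : ¬ v < k
    v≮k v<k with val w (k + p) in e
    ... | zero = <⇒≱ v≥1 (≤-reflexive e)
    ... | suc zero = <⇒≱ (m<m+n k 1≤p) (≤-reflexive (trans (sym wv≡k+p) (cong (val w) e)))
    ... | suc (suc p') = <⇒≱ (proj₂ (inside-values (suc p') (s≤s z≤n) (≤-pred (≤-pred v<k))))
                              (subst (k ≤_) (trans (sym wv≡k+p) (cong (val w) e)) (m≤m+n k p))

  Decomposition : Set
  Decomposition = ∃[ A ] ∃[ B ] (w' ≡ sh 1 A ++ 1 ∷ sh k B × k + length B ≡ n ×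
                                 AvoidingInvolution j A × AvoidingInvolution (length B) B)

  module Cut (A₀ : List ℕ) (y : ℕ) (B₀ : List ℕ) (w'≡ : w' ≡ A₀ ++ y ∷ B₀) (lenA₀ : length A₀ ≡ j) where
    n≡ : n ≡ k + length B₀
    n≡ = trans (sym length≡) (cong suc (trans (cong length w'≡) (trans (length-++ A₀)
           (trans (cong (_+ suc (length B₀)) lenA₀) (+-suc j (length B₀))))))

    y≡1 : y ≡ 1
    y≡1 = trans (sym (val-++ʳ A₀ (y ∷ B₀) 0))
            (trans (cong (λ u → val u (length A₀ + 1)) (sym w'≡))
              (trans (cong (val w') (trans (cong (_+ 1) lenA₀) (+-comm j 1))) val-k))

    w≡inner : w ≡ (k ∷ []) ++ A₀ ++ y ∷ B₀
    w≡inner = cong (k ∷_) w'≡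

    val-A₀ : ∀ i → 1 ≤ i → i ≤ length A₀ → val A₀ i ≡ val w (1 + i)
    val-A₀ i p q = sym (trans (cong (λ u → val u (1 + i)) w≡inner) (val-middle (k ∷ []) A₀ (y ∷ B₀) i p q))

    inner-bounds : ∀ i → 1 ≤ i → i ≤ length A₀ → 1 < val A₀ i × val A₀ i ≤ 1 + length A₀
    inner-bounds i p q with inside-values i p (subst (i ≤_) lenA₀ q)
    ... | 1< , <k rewrite val-A₀ i p q | lenA₀ = 1< , ≤-pred <k

    inner-restricted : AvoidingInvolution (length A₀) (unsh 1 A₀) × sh 1 (unsh 1 A₀) ≡ A₀
    inner-restricted = restrict (k ∷ []) A₀ (y ∷ B₀) 1 refl w≡inner I inner-bounds

    prefix : List ℕ
    prefix = k ∷ A₀ ++ y ∷ []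

    length-prefix : length prefix ≡ k
    length-prefix = cong suc (trans (length-++ A₀) (trans (cong (_+ 1) lenA₀) (+-comm j 1)))

    w≡outer : w ≡ prefix ++ B₀ ++ []
    w≡outer = cong (k ∷_) (trans w'≡ (trans (sym (++-assoc A₀ (y ∷ []) B₀)) (cong ((A₀ ++ y ∷ []) ++_) (sym (++-identityʳ B₀)))))

    val-B₀ : ∀ i → 1 ≤ i → i ≤ length B₀ → val B₀ i ≡ val w (k + i)
    val-B₀ i p q = sym (trans (cong (λ c → val w (c + i)) (sym length-prefix))
                     (trans (cong (λ u → val u (length prefix + i)) w≡outer) (val-middle prefix B₀ [] i p q)))

    outer-bounds : ∀ i → 1 ≤ i → i ≤ length B₀ → k < val B₀ i × val B₀ i ≤ k + length B₀
    outer-bounds i p q rewrite val-B₀ i p q =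
      outside-values i p k+i≤n , subst (val w (k + i) ≤_) n≡ (proj₂ (range (k + i) (s≤s z≤n) k+i≤n))
      where k+i≤n = subst (k + i ≤_) (sym n≡) (+-monoʳ-≤ k q)

    outer-restricted : AvoidingInvolution (length B₀) (unsh k B₀) × sh k (unsh k B₀) ≡ B₀
    outer-restricted = restrict prefix B₀ [] k length-prefix w≡outer I outer-bounds

  decompose-at : ∀ A₀ y B₀ → w' ≡ A₀ ++ y ∷ B₀ → length A₀ ≡ j → Decomposition
  decompose-at A₀ y B₀ w'≡ lenA₀ =
    unsh 1 A₀ , unsh k B₀ ,
    trans w'≡ (cong₂ _++_ (sym (proj₂ inner-restricted)) (cong₂ _∷_ y≡1 (sym (proj₂ outer-restricted)))) ,
    trans (cong (k +_) (length-map (_∸ k) B₀)) (sym n≡) ,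
    subst (λ m → AvoidingInvolution m (unsh 1 A₀)) lenA₀ (proj₁ inner-restricted) ,
    subst (λ m → AvoidingInvolution m (unsh k B₀)) (sym (length-map (_∸ k) B₀)) (proj₁ outer-restricted)
    where open Cut A₀ y B₀ w'≡ lenA₀

  decomposition : Decomposition
  decomposition = let (A₀ , y , B₀ , w'≡ , lenA₀) = split-at w' j (≤-pred (subst (k ≤_) (sym length≡) k≤n))
                  in decompose-at A₀ y B₀ w'≡ lenA₀

-- By induction on n (the bound is fuel): an avoiding involution is inv t.
avoiding-involution-is-inv : ∀ bound n w → n ≤ bound → AvoidingInvolution n w → ∃[ t ] (size t ≡ n × w ≡ inv t)
avoiding-involution-is-inv _ zero [] _ _ = leaf , refl , refl
avoiding-involution-is-inv _ zero (x ∷ w) _ I with AvoidingInvolution.length≡ I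
... | ()
avoiding-involution-is-inv _ (suc n) [] _ I with AvoidingInvolution.length≡ I
... | ()
avoiding-involution-is-inv _ (suc n) (zero ∷ w') _ I = ⊥-elim (<⇒≱ (proj₁ (AvoidingInvolution.range I 1 ≤-refl (s≤s z≤n))) z≤n)
avoiding-involution-is-inv (suc bound) (suc n) (suc zero ∷ w') (s≤s n≤bound) I with fixed-first I
... | I′ , shifted with avoiding-involution-is-inv bound n (unsh 1 w') n≤bound I′
... | t , refl , e = hstep t , refl , cong (1 ∷_) (trans (sym shifted) (cong (sh 1) e))
avoiding-involution-is-inv (suc bound) (suc n) (suc (suc j) ∷ w') (s≤s n≤bound) I with ArchCase.decomposition I
... | A , B , refl , k+m≡ , IA , IB
  with avoiding-involution-is-inv bound j A j≤bound IA | avoiding-involution-is-inv bound (length B) B m≤bound IB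
  where
  j≤bound = ≤-trans (≤-trans (n≤1+n j) (≤-pred (≤-trans (m≤m+n (suc (suc j)) (length B)) (≤-reflexive k+m≡)))) n≤bound
  m≤bound = ≤-trans (≤-pred (≤-trans (s≤s (m≤n+m (length B) (suc j))) (≤-reflexive k+m≡))) n≤bound
... | a , refl , refl | b , size-b , refl = arch a b , trans (cong (suc (suc (size a)) +_) size-b) k+m≡ , refl

record AvoidingPermutation (n : ℕ) (σ : List ℕ) : Set where
  field
    perm      : σ ↭ [1‥ n ]
    avoids132 : ¬ Pat132 σ
    avoids123 : ¬ C123 σ

perm-range : ∀ {n σ x} → σ ↭ [1‥ n ] → x ∈ σ → 1 ≤ x × x ≤ n
perm-range {n} p m = ∈[1‥]⇒range n (∈-resp-↭ p m)

perm-unique : ∀ {n σ} → σ ↭ [1‥ n ] → Unique σ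
perm-unique {n} p = Unique-resp-↭ (setoid ℕ) (↭⇒↭ₛ (↭-sym p)) (unique-[1‥] n)

unique-suffix : ∀ A {B : List ℕ} → Unique (A ++ B) → Unique B
unique-suffix [] u = u
unique-suffix (a ∷ A) (_ ∷ u) = unique-suffix A u

unique-disjoint : ∀ A {B : List ℕ} {x} → Unique (A ++ B) → x ∈ A → x ∉ B
unique-disjoint (a ∷ A) (a≢ ∷ _) (here refl) x∈B = All.lookup a≢ (∈-++⁺ʳ A x∈B) refl
unique-disjoint (a ∷ A) (_ ∷ u) (there m) = unique-disjoint A u m

unsh-sh : ∀ c L → unsh c (sh c L) ≡ L
unsh-sh c [] = refl
unsh-sh c (x ∷ L) = cong₂ _∷_ (m+n∸m≡n c x) (unsh-sh c L)

C123-++ʳ : ∀ A {B} → C123 B → C123 (A ++ B)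
C123-++ʳ [] c = c
C123-++ʳ (a ∷ A) {B} c = cons (A ++ B) (C123-++ʳ A c)
  where
  cons : ∀ L → C123 L → C123 (a ∷ L)
  cons (x ∷ y ∷ z ∷ r) c = inj₂ c

C123-++ˡ : ∀ A B → C123 A → C123 (A ++ B)
C123-++ˡ (x ∷ y ∷ z ∷ r) B (inj₁ p) = inj₁ p
C123-++ˡ (x ∷ y ∷ z ∷ r) B (inj₂ c) = inj₂ (C123-++ˡ (y ∷ z ∷ r) B c)

factor : ∀ {n σ} P δ Q c m → σ ≡ P ++ δ ++ Q → δ ↭ sh c [1‥ m ] → AvoidingPermutation n σ →
  AvoidingPermutation m (unsh c δ) × sh c (unsh c δ) ≡ δ
factor P δ Q c m refl p S = record { perm = perm′ ; avoids132 = avoids132′ ; avoids123 = avoids123′ } , shifted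
  where
  open AvoidingPermutation S
  shifted : sh c (unsh c δ) ≡ δ
  shifted = sh-unsh c (tabulate (λ x∈ → let (y , _ , e) = ∈-map⁻ (c +_) (∈-resp-↭ p x∈) in subst (c ≤_) (sym e) (m≤m+n c y)))
  perm′ : unsh c δ ↭ [1‥ m ]
  perm′ = subst (unsh c δ ↭_) (unsh-sh c [1‥ m ]) (↭-map⁺ (_∸ c) p)
  avoids132′ : ¬ Pat132 (unsh c δ)
  avoids132′ pat with 132-shift c _ pat
  ... | a , b , d , s , v = avoids132 (a , b , d , ⊑-++ʳ P (⊑-++ˡ Q (subst (a ∷ b ∷ d ∷ [] ⊑_) shifted s)) , v)
  avoids123′ : ¬ C123 (unsh c δ)
  avoids123′ c123 = avoids123 (C123-++ʳ P (C123-++ˡ δ Q (subst C123 shifted (C123-shift c _ c123))))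

filter-middle : ∀ {P : ℕ → Set} (P? : Decidable₁ P) A B C →
  All (λ x → ¬ P x) A → All P B → All (λ x → ¬ P x) C → filter P? (A ++ B ++ C) ≡ B
filter-middle P? A B C nA aB nC = begin
    filter P? (A ++ B ++ C)                    ≡⟨ filter-++ P? A (B ++ C) ⟩
    filter P? A ++ filter P? (B ++ C)          ≡⟨ cong₂ _++_ (filter-none P? nA) (filter-++ P? B C) ⟩
    filter P? B ++ filter P? C                 ≡⟨ cong₂ _++_ (filter-all P? aB) (filter-none P? nC) ⟩
    B ++ []                                    ≡⟨ ++-identityʳ B ⟩
    B                                          ∎
  where open ≡-Reasoning

-- Where 1 can sit in an avoiding permutation σ = α ++ 1 ∷ ρ: ρ has at most one
-- entry, since 1 x y is an occurrence of 123 or of 132.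
one-followed-by-two : ∀ {n} α x y ρ → ¬ AvoidingPermutation n (α ++ 1 ∷ x ∷ y ∷ ρ)
one-followed-by-two {n} α x y ρ S with unique-suffix α (perm-unique perm)
  where open AvoidingPermutation S
... | 1∉ ∷ (x∉ ∷ _) with <-cmp x y
... | tri≈ _ x≡y _ = All.lookup x∉ (here refl) x≡y
... | tri< x<y _ _ = AvoidingPermutation.avoids123 S (C123-++ʳ α (inj₁ (above-1 x (there (here refl)) (All.lookup 1∉ (here refl)) , x<y)))
  where
  above-1 : ∀ z → z ∈ 1 ∷ x ∷ y ∷ ρ → 1 ≢ z → 1 < z
  above-1 z z∈ 1≢z = ≤∧≢⇒< (proj₁ (perm-range (AvoidingPermutation.perm S) (∈-++⁺ʳ α z∈))) 1≢z
... | tri> _ _ y<x = AvoidingPermutation.avoids132 S (1 , x , y , ⊑-++ʳ α (keep (keep (keep nil))) , 1<y , y<x)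
  where
  1<y = ≤∧≢⇒< (proj₁ (perm-range (AvoidingPermutation.perm S) (∈-++⁺ʳ α (there (there (here refl)))))) (All.lookup 1∉ (there (here refl)))

split-around : ∀ α k → All (_≢ k) α → (∀ a b → (a ∷ b ∷ []) ⊑ α → a < k → k < b → ⊥) →
  ∃[ β ] ∃[ γ ] (α ≡ β ++ γ × All (k <_) β × All (_< k) γ)
split-around [] k _ _ = [] , [] , refl , [] , []
split-around (x ∷ α) k (x≢k ∷ α≢k) no-132 with <-cmp k x
... | tri≈ _ k≡x _ = ⊥-elim (x≢k (sym k≡x))
... | tri< k<x _ _ with split-around α k α≢k (λ a b s → no-132 a b (skip s))
... | β , γ , refl , aβ , aγ = x ∷ β , γ , refl , k<x ∷ aβ , aγ
split-around (x ∷ α) k (x≢k ∷ α≢k) no-132 | tri> _ _ x<k = [] , x ∷ α , refl , [] , x<k ∷ tabulate below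
  where
  below : ∀ {y} → y ∈ α → y < k
  below {y} m with <-cmp y k
  ... | tri< y<k _ _ = y<k
  ... | tri≈ _ y≡k _ = ⊥-elim (All.lookup α≢k m y≡k)
  ... | tri> _ _ k<y = ⊥-elim (no-132 x y (keep (∈⇒⊑ m)) x<k k<y)

-- An avoiding permutation ending in 1 k, k = j+2, is the cyc-word of an arch:
-- its other entries split into a block above k followed by a block 2‥k-1.
module PermArchCase {n j α} (S : AvoidingPermutation n (α ++ 1 ∷ suc (suc j) ∷ [])) where
  open AvoidingPermutation S

  k : ℕ
  k = suc (suc j)

  σ : List ℕ
  σ = α ++ 1 ∷ k ∷ []

  k≤n : k ≤ n
  k≤n = proj₂ (perm-range perm (∈-++⁺ʳ α (there (here refl))))

  m : ℕ
  m = n ∸ k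

  k+m≡n : k + m ≡ n
  k+m≡n = m+[n∸m]≡n k≤n

  uniqueσ : Unique σ
  uniqueσ = perm-unique perm

  parts : ∃[ β ] ∃[ γ ] (α ≡ β ++ γ × All (k <_) β × All (_< k) γ)
  parts = split-around α k (tabulate (λ m e → unique-disjoint α uniqueσ m (there (here e))))
    (λ a b s a<k k<b → avoids132 (a , b , k , ⊑-++ s (skip (keep nil)) , a<k , k<b))

  β γ : List ℕ
  β = proj₁ parts
  γ = proj₁ (proj₂ parts)

  α≡ : α ≡ β ++ γ
  α≡ = proj₁ (proj₂ (proj₂ parts))

  β-above : All (k <_) β
  β-above = proj₁ (proj₂ (proj₂ (proj₂ parts)))

  γ-range : All (λ x → 1 < x × x < k) γ
  γ-range = tabulate (λ y∈ → ≤∧≢⇒< (proj₁ (perm-range perm (∈-++⁺ˡ (in-α y∈)))) (λ e → unique-disjoint α uniqueσ (in-α y∈) (here (sym e)))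
                           , All.lookup (proj₂ (proj₂ (proj₂ (proj₂ parts)))) y∈)
    where
    in-α : ∀ {y} → y ∈ γ → y ∈ α
    in-α y∈ = subst (_ ∈_) (sym α≡) (∈-++⁺ʳ β y∈)

  σ≡ : σ ≡ β ++ γ ++ 1 ∷ k ∷ []
  σ≡ = trans (cong (_++ 1 ∷ k ∷ []) α≡) (++-assoc β γ _)

  X Y : List ℕ
  X = sh 1 [1‥ j ]
  Y = sh k [1‥ m ]

  X-range : All (λ x → 1 < x × x < k) X
  X-range = All.map⁺ (tabulate (λ m → let (a , b) = ∈[1‥]⇒range j m in s≤s a , s≤s (s≤s b)))

  Y-above : All (k <_) Y
  Y-above = sh-above k (tabulate (λ m → proj₁ (∈[1‥]⇒range _ m)))

  perm′ : β ++ γ ++ 1 ∷ k ∷ [] ↭ 1 ∷ X ++ k ∷ Y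
  perm′ = subst₂ _↭_ σ≡ (trans (cong [1‥_] (sym k+m≡n)) ([1‥arch] j m)) perm

  -- Selecting the entries above k on both sides of perm′ gives β ↭ Y.
  not-above : ∀ {x} → x ≤ k → ¬ k < x
  not-above x≤k k<x = <⇒≱ k<x x≤k

  β-perm : β ↭ Y
  β-perm = subst₂ _↭_
    (filter-middle (k <?_) [] β (γ ++ 1 ∷ k ∷ []) [] β-above
      (All.map not-above (All.++⁺ (All.map (λ q → <⇒≤ (proj₂ q)) γ-range) (s≤s z≤n ∷ ≤-refl ∷ []))))
    (trans (cong (filter (k <?_)) τ≡)
      (filter-middle (k <?_) (1 ∷ X ++ k ∷ []) Y [] (All.map not-above (s≤s z≤n ∷ All.++⁺ (All.map (λ q → <⇒≤ (proj₂ q)) X-range) (≤-refl ∷ []))) Y-above []))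
    (filter-↭ (k <?_) perm′)
    where
    τ≡ : 1 ∷ X ++ k ∷ Y ≡ (1 ∷ X ++ k ∷ []) ++ Y ++ []
    τ≡ = cong (1 ∷_) (trans (sym (++-assoc X (k ∷ []) Y)) (cong ((X ++ k ∷ []) ++_) (sym (++-identityʳ Y))))

  -- Selecting the entries strictly between 1 and k gives γ ↭ X.
  inside? : Decidable₁ (λ x → 1 < x × x < k)
  inside? x = (1 <? x) ×-dec (x <? k)

  not-inside : ∀ {x} → x ≤ 1 ⊎ k ≤ x → ¬ (1 < x × x < k)
  not-inside (inj₁ x≤1) (1<x , _) = <⇒≱ 1<x x≤1
  not-inside (inj₂ k≤x) (_ , x<k) = <⇒≱ x<k k≤x

  γ-perm : γ ↭ X
  γ-perm = subst₂ _↭_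
    (filter-middle inside? β γ (1 ∷ k ∷ []) (All.map (λ k<x → not-inside (inj₂ (<⇒≤ k<x))) β-above) γ-range
      (not-inside (inj₁ ≤-refl) ∷ not-inside (inj₂ ≤-refl) ∷ []))
    (filter-middle inside? (1 ∷ []) X (k ∷ Y) (not-inside (inj₁ ≤-refl) ∷ []) X-range
      (not-inside (inj₂ ≤-refl) ∷ All.map (λ k<x → not-inside (inj₂ (<⇒≤ k<x))) Y-above))
    (filter-↭ inside? perm′)

  outer-factor : AvoidingPermutation m (unsh k β) × sh k (unsh k β) ≡ β
  outer-factor = factor [] β (γ ++ 1 ∷ k ∷ []) k m σ≡ β-perm S

  inner-factor : AvoidingPermutation j (unsh 1 γ) × sh 1 (unsh 1 γ) ≡ γ
  inner-factor = factor β γ (1 ∷ k ∷ []) 1 j σ≡ γ-perm S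

-- By induction on n (the bound is fuel): an avoiding permutation is cyc t.
avoiding-permutation-is-cyc : ∀ bound n σ → n ≤ bound → AvoidingPermutation n σ → ∃[ t ] (size t ≡ n × σ ≡ cyc t)
avoiding-permutation-is-cyc _ zero σ _ S = leaf , refl , ↭-empty-inv (AvoidingPermutation.perm S)
avoiding-permutation-is-cyc (suc bound) (suc n) σ (s≤s n≤bound) S
  with ∈-∃++ (∈-resp-↭ (↭-sym (AvoidingPermutation.perm S)) (range⇒∈[1‥] (suc n) ≤-refl (s≤s z≤n)))
... | α , [] , refl with factor [] α (1 ∷ []) 1 n refl α-perm S
  where
  α-perm = subst (_↭ sh 1 [1‥ n ]) (++-identityʳ α)
                 (drop-mid α [] (subst (α ++ 1 ∷ [] ↭_) ([1‥suc] n) (AvoidingPermutation.perm S)))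
... | S′ , shifted with avoiding-permutation-is-cyc bound n (unsh 1 α) n≤bound S′
... | t , refl , e = hstep t , refl , cong (_++ 1 ∷ []) (trans (sym shifted) (cong (sh 1) e))
avoiding-permutation-is-cyc (suc bound) (suc n) σ (s≤s n≤bound) S | α , x ∷ y ∷ ρ , refl = ⊥-elim (one-followed-by-two α x y ρ S)
avoiding-permutation-is-cyc (suc bound) (suc n) σ (s≤s n≤bound) S | α , zero ∷ [] , refl =
  ⊥-elim (<⇒≱ (proj₁ (perm-range (AvoidingPermutation.perm S) (∈-++⁺ʳ α (there (here refl))))) z≤n)
avoiding-permutation-is-cyc (suc bound) (suc n) σ (s≤s n≤bound) S | α , suc zero ∷ [] , refl =
  ⊥-elim (Unique[x∷xs]⇒x∉xs (unique-suffix α (perm-unique (AvoidingPermutation.perm S))) (here refl))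
avoiding-permutation-is-cyc (suc bound) (suc n) σ (s≤s n≤bound) S | α , suc (suc j) ∷ [] , refl
  with PermArchCase.outer-factor S | PermArchCase.inner-factor S
... | Sb , shifted-b | Sa , shifted-a
  with avoiding-permutation-is-cyc bound j _ j≤bound Sa | avoiding-permutation-is-cyc bound (suc n ∸ suc (suc j)) _ m≤bound Sb
  where
  k+m≡ = PermArchCase.k+m≡n S
  j≤bound = ≤-trans (≤-trans (n≤1+n j) (≤-pred (≤-trans (m≤m+n (suc (suc j)) _) (≤-reflexive k+m≡)))) n≤bound
  m≤bound = ≤-trans (≤-pred (≤-trans (s≤s (m≤n+m _ (suc j))) (≤-reflexive k+m≡))) n≤bound
... | a , refl , ea | b , sb , eb = arch a b , trans (cong (suc (suc (size a)) +_) sb) (PermArchCase.k+m≡n S) ,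
  trans (PermArchCase.σ≡ S) (cong₂ (λ B A → B ++ A ++ 1 ∷ suc (suc (size a)) ∷ [])
                                   (trans (sym shifted-b) (cong (sh (suc (suc (size a)))) eb))
                                   (trans (sym shifted-a) (cong (sh 1) ea)))

inv-param : ∀ n → Parametrizes (λ t → size t ≡ n) inv (I3412 n)
inv-param n = record { sound = sound′ ; complete = complete′ }
  where
  sound′ : ∀ t → size t ≡ n → I3412 n (inv t)
  sound′ t refl = (inv-perm t , inv-involutive t) , (λ c → inv-avoids-3412 t (Contains3412⇒Pat (inv t) c))
  complete′ : ∀ π → I3412 n π → ∃[ t ] (size t ≡ n × π ≡ inv t)
  complete′ π ((p , involutive) , no-3412) = avoiding-involution-is-inv n n π ≤-refl record
    { length≡ = length≡ ; range = range ; involutive = involutive ; avoids = λ pat → no-3412 (Pat3412⇒Contains π pat) }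
    where
    length≡ = trans (↭-length p) (length-[1‥] n)
    range : ∀ i → 1 ≤ i → i ≤ n → 1 ≤ val π i × val π i ≤ n
    range (suc i) _ q = perm-range p (val-∈ π i (subst (suc i ≤_) (sym length≡) q))

cyc-param : ∀ n → Parametrizes (λ t → size t ≡ n) cyc (S132c123 n)
cyc-param n = record { sound = sound′ ; complete = complete′ }
  where
  sound′ : ∀ t → size t ≡ n → S132c123 n (cyc t)
  sound′ t refl = cyc-perm t , (λ c → cyc-avoids-132 t (Contains132⇒Pat (cyc t) c))
                             , (λ c → cyc-avoids-C123 t (ContainsCons123⇒C123 (cyc t) c))
  complete′ : ∀ σ → S132c123 n σ → ∃[ t ] (size t ≡ n × σ ≡ cyc t)
  complete′ σ (p , no-132 , no-123) = avoiding-permutation-is-cyc n n σ ≤-refl record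
    { perm = p ; avoids132 = λ pat → no-132 (Pat132⇒Contains σ pat) ; avoids123 = λ c → no-123 (C123⇒ContainsCons123 σ c) }

cyc-injective : ∀ {t t'} → cyc t ≡ cyc t' → t ≡ t'
cyc-injective {t} {t'} e = motz-injective (trans (sym (Γ-cyc t)) (trans (cong Γ e) (Γ-cyc t')))

mainTheorem3 : (n : ℕ) →
    BijOnto (I3412 n) (S132c123 n) F ×
    BijOnto (S132c123 n) (MotzZero n) Γ ×
    BijOnto (I3412 n) (MotzZero n) Ψ ×
    (∀ (π : List ℕ) → I3412 n π → Ψ π ≡ Γ (F π))
mainTheorem3 n =
  transport F (inv-param n) (cyc-param n) F-inv cyc-injective ,
  transport Γ (cyc-param n) (motz-param n) Γ-cyc motz-injective ,
  transport Ψ (inv-param n) (motz-param n) Ψ-inv motz-injective ,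
  Ψ≡Γ∘F
  where
  Ψ≡Γ∘F : ∀ π → I3412 n π → Ψ π ≡ Γ (F π)
  Ψ≡Γ∘F π I with complete (inv-param n) π I
  ... | t , _ , refl = begin
      Ψ (inv t)      ≡⟨ Ψ-inv t ⟩
      motz t         ≡⟨ sym (Γ-cyc t) ⟩
      Γ (cyc t)      ≡⟨ cong Γ (sym (F-inv t)) ⟩
      Γ (F (inv t))  ∎
    where open ≡-Reasoning
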